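{- Let $h\in\mathbb{Z}$. The generating function $\sum_{n\ge0} c_h(n)q^n$, where $c_h(n)$ is the number of partitions $\lambda=(\lambda_1,\dots,\lambda_t)\vdash n$ having an $h$-fixed hook (i.e. there is $s$ with $1\le s\le t$ and $h_{s,1}(\lambda)=s+h$), equals $$\sum_{k=1}^\infty\sum_{l=1}^k \frac{q^{k+l(k-h-1)}}{(q)_{k-h-1}}\begin{bmatrix} k-1\\ l-1\end{bmatrix}_q=\sum_{l=1}^\infty q^{l(-h-1)}\sum_{k=l}^\infty \frac{q^{(l+1)k}}{(q)_{k-h-1}}\begin{bmatrix} k-1\\ l-1\end{bmatrix}_q.$$
   Context: A partition $\lambda=(\lambda_1,\dots,\lambda_t)$ of $n$ is a nonincreasing sequence of positive integers with sum $n$. First-column hook lengths: $h_{s,1}(\lambda)=\lambda_s+t-s$ for $1\le s\le t$. An $h$-fixed hook is an index $s$ with $h_{s,1}(\lambda)=s+h$ (at most one exists). Notation: $(a;q)_\infty=\prod_{j\ge0}(1-aq^j)$, $(q)_m=(q;q)_\infty/(q^{m+1};q)_\infty$ (so $1/(q)_m=0$ for negative integers $m$), and $\begin{bmatrix} A\\ B\end{bmatrix}_q=\frac{(q)_A}{(q)_B(q)_{A-B}}$. -}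

module Defs where

open import Data.Nat as ℕ using (ℕ; zero; suc; _∸_; _≥_; _<_; _≥?_; _<?_; _%_)
import Data.Nat.Properties as ℕP
open import Data.Integer as ℤ using (ℤ; +_; -[1+_]; _+_; _*_; _-_; -_)
import Data.Integer.Properties as ℤP
open import Data.List as List using (List; []; _∷_; map; upTo; concat; length; filter; foldr; lookup)
open import Data.List.Relation.Unary.All as All using (All; all?)
open import Data.List.Relation.Unary.Linked using (Linked; linked?)
open import Data.Fin as Fin using (Fin; toℕ)
open import Data.Fin.Properties using (any?)
open import Data.Product using (Σ; ∃; _×_)
open import Relation.Binary.PropositionalEquality using (_≡_)
open import Relation.Nullary using (Dec; yes; no)
open import Relation.Nullary.Decidable using (_×-dec_)

sumℕ : List ℕ → ℕ
sumℕ = foldr ℕ._+_ 0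

IsPartition : ℕ → List ℕ → Set
IsPartition n λs = All (0 <_) λs × Linked _≥_ λs × sumℕ λs ≡ n

-- first-column hook length h_{s,1}(λ) = λ_s + t - s  (s = toℕ i + 1, t = length λ)
hook1 : (λs : List ℕ) → Fin (length λs) → ℤ
hook1 λs i = (+ lookup λs i + + length λs) - + suc (toℕ i)

HasFixedHook : ℤ → List ℕ → Set
HasFixedHook h λs = ∃ λ (i : Fin (length λs)) → hook1 λs i ≡ + suc (toℕ i) + h

isPartition? : ∀ n λs → Dec (IsPartition n λs)
isPartition? n λs = all? (λ x → 0 <? x) λs ×-dec (linked? ℕ._≥?_ λs ×-dec (sumℕ λs ℕ.≟ n))

hasFixedHook? : ∀ h λs → Dec (HasFixedHook h λs)
hasFixedHook? h λs = any? (λ i → hook1 λs i ℤ.≟ (+ suc (toℕ i) + h))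

range : ℕ → ℕ → List ℕ
range a b = map (a ℕ.+_) (upTo (suc b ∸ a))

listsOf : ℕ → ℕ → List (List ℕ)
listsOf zero    n = [] ∷ []
listsOf (suc t) n = concat (map (λ x → map (x ∷_) (listsOf t n)) (range 1 n))

-- finite candidate set: every list of length ≤ n with entries in {1..n}
-- (contains every partition of n exactly once)
candidates : ℕ → List (List ℕ)
candidates n = concat (map (λ t → listsOf t n) (upTo (suc n)))

c : ℤ → ℕ → ℕ
c h n = length (filter (λ λs → isPartition? n λs ×-dec hasFixedHook? h λs) (candidates n))

Series : Set
Series = ℕ → ℤ

sumℤ : List ℤ → ℤ
sumℤ = foldr _+_ (+ 0)

zeroS : Series
zeroS _ = + 0

mono : ℕ → Series
mono e n with e ℕ.≟ n
... | yes _ = + 1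
... | no  _ = + 0

oneS : Series
oneS = mono 0

_⊕_ : Series → Series → Series
(f ⊕ g) n = f n + g n

_⊖_ : Series → Series → Series
(f ⊖ g) n = f n - g n

_⊛_ : Series → Series → Series
(f ⊛ g) n = sumℤ (map (λ i → f i * g (n ∸ i)) (upTo (suc n)))

infixl 7 _⊛_

coeffZ : Series → ℤ → ℤ
coeffZ f (+ m)    = f m
coeffZ f -[1+ _ ] = + 0

poch : ℕ → Series
poch zero    = oneS
poch (suc m) = poch m ⊛ (oneS ⊖ mono (suc m))

-- 1/(1 - q^j) = Σ_{r ≥ 0} q^{j r}  for j ≥ 1 (written j = suc i)
geom : ℕ → Series
geom i n with n % suc i ℕ.≟ 0
... | yes _ = + 1
... | no  _ = + 0

invPoch : ℕ → Series
invPoch zero    = oneS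
invPoch (suc m) = invPoch m ⊛ geom m

-- 1/(q)_m for integer m (0 for negative m, as in the paper's convention)
invPochZ : ℤ → Series
invPochZ (+ m)    = invPoch m
invPochZ -[1+ _ ] = zeroS

-- q-binomial [A; B]_q = (q)_A / ((q)_B (q)_{A-B})  (used with B ≤ A)
qbinom : ℕ → ℕ → Series
qbinom A B = poch A ⊛ invPoch B ⊛ invPoch (A ∸ B)

-- coefficient of q^n in  q^{k + l(k-h-1)} / (q)_{k-h-1} * [k-1; l-1]_q
term1 : ℤ → ℕ → ℕ → ℕ → ℤ
term1 h k l n =
  coeffZ (invPochZ (+ k - h - + 1) ⊛ qbinom (k ∸ 1) (l ∸ 1))
         (+ n - (+ k + + l * (+ k - h - + 1)))

partial1 : ℤ → ℕ → ℕ → ℤ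
partial1 h K n = sumℤ (map (λ k → sumℤ (map (λ l → term1 h k l n) (range 1 k))) (range 1 K))

-- coefficient of q^n in  q^{l(-h-1)} * q^{(l+1)k} / (q)_{k-h-1} * [k-1; l-1]_q
term2 : ℤ → ℕ → ℕ → ℕ → ℤ
term2 h l k n =
  coeffZ (mono (suc l ℕ.* k) ⊛ invPochZ (+ k - h - + 1) ⊛ qbinom (k ∸ 1) (l ∸ 1))
         (+ n - + l * (- h - + 1))

inner2 : ℤ → ℕ → ℕ → ℕ → ℤ
inner2 h l K n = sumℤ (map (λ k → term2 h l k n) (range l K))

{-# OPTIONS --safe #-}

-- If a partition λ of length t has its h-fixed hook in row s = j + 1, write λ = ys ++ x ∷ zs
-- with |ys| = j, x = λ_s and |zs| = m. The hook condition becomes x + m = j + 1 + h, and the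
-- row s is unique because λ_s + t − 2s strictly decreases in s. The rows above s form a
-- partition into j parts ≥ x, counted by q^(jx)/(q)_j, and the rows below form a partition
-- into m parts ≤ x, counted by q^m [m+x−1; m]_q. With k = x + m and l = x (so j = k − h − 1)
-- this product is the (k, l) summand q^(k + l(k−h−1))/(q)_(k−h−1) [k−1; l−1]_q, and the
-- second double series regroups the same summands via k + l(k−h−1) = l(−h−1) + (l+1)k.
-- Only summands with k ≤ n reach q^n, so every coefficient sum is finite and stabilises.

module Submission where

open import Defs
open import Algebra.Bundles using (CommutativeRing)
import Algebra.Properties.CommutativeSemigroup as CommSemigroupProperties
import Algebra.Solver.Ring
open import Algebra.Solver.Ring.AlmostCommutativeRing using (_-Raw-AlmostCommutative⟶_; fromCommutativeRing)
open import Data.Empty using (⊥; ⊥-elim)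
open import Data.Fin as Fin using (Fin; toℕ; fromℕ<)
import Data.Fin.Properties as FinP
open import Data.Integer as ℤ using (ℤ; +_; -[1+_]; _+_; _*_; _-_; -_)
import Data.Integer.Properties as ℤP
open import Data.Integer.Tactic.RingSolver using (solve-∀)
open import Data.List as List using (List; []; _∷_; map; upTo; concat; _++_; [_]; length; lookup; filter)
import Data.List.Properties as ListP
open import Data.List.Relation.Unary.All using (All; []; _∷_)
open import Data.List.Relation.Unary.Linked as Linked using (Linked; []; [-]; _∷_)
import Data.Maybe as Maybe
open import Data.Nat as ℕ using (ℕ; zero; suc; _∸_; _≤_; _<_; _≥_; z≤n; s≤s; _≤?_; _<?_)
open import Data.Nat.DivMod using (_%_; m<n⇒m%n≡m; m≤n⇒[n∸m]%m≡n%m)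
open import Data.Nat.ListAction.Properties using (sum-++)
import Data.Nat.Properties as ℕP
import Data.Nat.Tactic.RingSolver as ℕSolver
open import Data.Product using (_×_; _,_; ∃; ∃-syntax)
open import Data.Unit using (⊤; tt)
open import Function using (_∘_; _⇔_; mk⇔; Equivalence)
open import Level using (0ℓ)
open import Relation.Binary.Bundles using (Setoid)
open import Relation.Binary.Definitions using (Tri; tri<; tri≈; tri>)
open import Relation.Binary.PropositionalEquality hiding ([_])
open import Relation.Nullary using (Dec; yes; no; ¬_; dec⇒maybe)
open import Relation.Nullary.Decidable using (_×-dec_)
open import Relation.Unary using (Pred; Decidable)
open ≡-Reasoning

private
  module ℤ+ = CommSemigroupProperties ℤP.+-commutativeSemigroup
  module ℤ* = CommSemigroupProperties ℤP.*-commutativeSemigroup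
  module ℕ+ = CommSemigroupProperties ℕP.+-commutativeSemigroup

-- Finite sums and indicators

∑ : {A : Set} → (A → ℤ) → List A → ℤ
∑ f xs = sumℤ (map f xs)

∑< : ℕ → (ℕ → ℤ) → ℤ
∑< n f = ∑ f (upTo n)

module _ {A : Set} where

  ∑-cong : {f g : A → ℤ} → (∀ x → f x ≡ g x) → ∀ xs → ∑ f xs ≡ ∑ g xs
  ∑-cong f≗g []       = refl
  ∑-cong f≗g (x ∷ xs) = cong₂ _+_ (f≗g x) (∑-cong f≗g xs)

  ∑-map : {B : Set} (f : A → ℤ) (g : B → A) (xs : List B) → ∑ f (map g xs) ≡ ∑ (f ∘ g) xs
  ∑-map f g []       = refl
  ∑-map f g (x ∷ xs) = cong (_+_ (f (g x))) (∑-map f g xs)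

  ∑-++ : (f : A → ℤ) (xs ys : List A) → ∑ f (xs ++ ys) ≡ ∑ f xs + ∑ f ys
  ∑-++ f []       ys = sym (ℤP.+-identityˡ _)
  ∑-++ f (x ∷ xs) ys = trans (cong (_+_ (f x)) (∑-++ f xs ys)) (sym (ℤP.+-assoc (f x) _ _))

  ∑-concat : (f : A → ℤ) (xss : List (List A)) → ∑ f (concat xss) ≡ ∑ (∑ f) xss
  ∑-concat f []         = refl
  ∑-concat f (xs ∷ xss) = trans (∑-++ f xs (concat xss)) (cong (_+_ (∑ f xs)) (∑-concat f xss))

  ∑-zero : {f : A → ℤ} → (∀ x → f x ≡ + 0) → ∀ xs → ∑ f xs ≡ + 0
  ∑-zero f≗0 []       = refl
  ∑-zero f≗0 (x ∷ xs) = cong₂ _+_ (f≗0 x) (∑-zero f≗0 xs)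

  ∑-+ : (f g : A → ℤ) (xs : List A) → ∑ (λ x → f x + g x) xs ≡ ∑ f xs + ∑ g xs
  ∑-+ f g []       = refl
  ∑-+ f g (x ∷ xs) = trans (cong (_+_ (f x + g x)) (∑-+ f g xs)) (ℤ+.interchange (f x) (g x) _ _)

  ∑-*ˡ : (a : ℤ) (f : A → ℤ) (xs : List A) → a * ∑ f xs ≡ ∑ (λ x → a * f x) xs
  ∑-*ˡ a f []       = ℤP.*-zeroʳ a
  ∑-*ˡ a f (x ∷ xs) = trans (ℤP.*-distribˡ-+ a (f x) _) (cong (_+_ (a * f x)) (∑-*ˡ a f xs))

  ∑-*ʳ : (a : ℤ) (f : A → ℤ) (xs : List A) → ∑ f xs * a ≡ ∑ (λ x → f x * a) xs
  ∑-*ʳ a f xs = trans (ℤP.*-comm _ a) (trans (∑-*ˡ a f xs) (∑-cong (λ x → ℤP.*-comm a (f x)) xs))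

∑-concatMap : {A B : Set} (f : A → ℤ) (g : B → List A) (xs : List B) →
              ∑ f (concat (map g xs)) ≡ ∑ (∑ f ∘ g) xs
∑-concatMap f g xs = trans (∑-concat f (map g xs)) (∑-map (∑ f) g xs)

∑-comm : {A B : Set} (F : A → B → ℤ) (xs : List A) (ys : List B) →
         ∑ (λ x → ∑ (F x) ys) xs ≡ ∑ (λ y → ∑ (λ x → F x y) xs) ys
∑-comm F []       ys = sym (∑-zero (λ _ → refl) ys)
∑-comm F (x ∷ xs) ys = trans (cong (_+_ (∑ (F x) ys)) (∑-comm F xs ys)) (sym (∑-+ (F x) _ ys))

∑-product : {A B : Set} (R : ℕ) (F : A → ℕ → ℤ) (G : B → ℕ → ℤ) (xs : List A) (ys : List B) →
            ∑ (λ x → ∑ (λ y → ∑< R (λ r → F x r * G y r)) ys) xs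
              ≡ ∑< R (λ r → ∑ (λ x → F x r) xs * ∑ (λ y → G y r) ys)
∑-product R F G xs ys = begin
  ∑ (λ x → ∑ (λ y → ∑< R (λ r → F x r * G y r)) ys) xs
    ≡⟨ ∑-cong (λ x → ∑-comm (λ y r → F x r * G y r) ys (upTo R)) xs ⟩
  ∑ (λ x → ∑< R (λ r → ∑ (λ y → F x r * G y r) ys)) xs
    ≡⟨ ∑-comm (λ x r → ∑ (λ y → F x r * G y r) ys) xs (upTo R) ⟩
  ∑< R (λ r → ∑ (λ x → ∑ (λ y → F x r * G y r) ys) xs)
    ≡⟨ ∑-cong (λ r → ∑-cong (λ x → ∑-*ˡ (F x r) (λ y → G y r) ys) xs) (upTo R) ⟨
  ∑< R (λ r → ∑ (λ x → F x r * ∑ (λ y → G y r) ys) xs)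
    ≡⟨ ∑-cong (λ r → ∑-*ʳ (∑ (λ y → G y r) ys) (λ x → F x r) xs) (upTo R) ⟨
  ∑< R (λ r → ∑ (λ x → F x r) xs * ∑ (λ y → G y r) ys) ∎

∑<-sucˡ : (n : ℕ) (f : ℕ → ℤ) → ∑< (suc n) f ≡ f 0 + ∑< n (f ∘ suc)
∑<-sucˡ n f = cong (_+_ (f 0)) (cong sumℤ (trans (ListP.map-applyUpTo suc f n) (sym (ListP.map-upTo (f ∘ suc) n))))

∑<-sucʳ : (n : ℕ) (f : ℕ → ℤ) → ∑< (suc n) f ≡ ∑< n f + f n
∑<-sucʳ n f = begin
  ∑ f (upTo (suc n))     ≡⟨ cong (∑ f) (ListP.upTo-∷ʳ n) ⟨
  ∑ f (upTo n ++ [ n ])  ≡⟨ ∑-++ f (upTo n) [ n ] ⟩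
  ∑< n f + (f n + + 0)   ≡⟨ cong (_+_ (∑< n f)) (ℤP.+-identityʳ (f n)) ⟩
  ∑< n f + f n           ∎

∑<-cong : (n : ℕ) {f g : ℕ → ℤ} → (∀ i → i < n → f i ≡ g i) → ∑< n f ≡ ∑< n g
∑<-cong zero    f≗g = refl
∑<-cong (suc n) {f} {g} f≗g = begin
  ∑< (suc n) f   ≡⟨ ∑<-sucʳ n f ⟩
  ∑< n f + f n   ≡⟨ cong₂ _+_ (∑<-cong n (λ i i<n → f≗g i (ℕP.m<n⇒m<1+n i<n))) (f≗g n ℕP.≤-refl) ⟩
  ∑< n g + g n   ≡⟨ ∑<-sucʳ n g ⟨
  ∑< (suc n) g   ∎

∑<-zero : (n : ℕ) {f : ℕ → ℤ} → (∀ i → i < n → f i ≡ + 0) → ∑< n f ≡ + 0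
∑<-zero n f≗0 = trans (∑<-cong n f≗0) (∑-zero (λ _ → refl) (upTo n))

∑<-+ : (a b : ℕ) (f : ℕ → ℤ) → ∑< (a ℕ.+ b) f ≡ ∑< a f + ∑< b (λ i → f (a ℕ.+ i))
∑<-+ zero    b f = sym (ℤP.+-identityˡ _)
∑<-+ (suc a) b f = begin
  ∑< (suc (a ℕ.+ b)) f                                    ≡⟨ ∑<-sucˡ (a ℕ.+ b) f ⟩
  f 0 + ∑< (a ℕ.+ b) (f ∘ suc)                            ≡⟨ cong (_+_ (f 0)) (∑<-+ a b (f ∘ suc)) ⟩
  f 0 + (∑< a (f ∘ suc) + ∑< b (λ i → f (suc a ℕ.+ i)))   ≡⟨ ℤP.+-assoc (f 0) _ _ ⟨
  f 0 + ∑< a (f ∘ suc) + ∑< b (λ i → f (suc a ℕ.+ i))     ≡⟨ cong (_+ ∑< b (λ i → f (suc a ℕ.+ i))) (∑<-sucˡ a f) ⟨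
  ∑< (suc a) f + ∑< b (λ i → f (suc a ℕ.+ i))             ∎

∑<-window : (c L N : ℕ) (f g : ℕ → ℤ) → c ℕ.+ L ≤ N →
            (∀ i → i < c → f i ≡ + 0) →
            (∀ i → i < L → f (c ℕ.+ i) ≡ g i) →
            (∀ i → L ≤ i → c ℕ.+ i < N → f (c ℕ.+ i) ≡ + 0) →
            ∑< N f ≡ ∑< L g
∑<-window c L N f g c+L≤N below inside above = begin
  ∑< N f                                          ≡⟨ cong (λ M → ∑< M f) (ℕP.m+[n∸m]≡n c+L≤N) ⟨
  ∑< (c ℕ.+ L ℕ.+ (N ∸ (c ℕ.+ L))) f              ≡⟨ ∑<-+ (c ℕ.+ L) _ f ⟩
  ∑< (c ℕ.+ L) f + ∑< (N ∸ (c ℕ.+ L)) _           ≡⟨ cong (_+_ (∑< (c ℕ.+ L) f)) (∑<-zero _ after) ⟩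
  ∑< (c ℕ.+ L) f + + 0                            ≡⟨ ℤP.+-identityʳ _ ⟩
  ∑< (c ℕ.+ L) f                                  ≡⟨ ∑<-+ c L f ⟩
  ∑< c f + ∑< L (λ i → f (c ℕ.+ i))               ≡⟨ cong₂ _+_ (∑<-zero c below) (∑<-cong L inside) ⟩
  + 0 + ∑< L g                                    ≡⟨ ℤP.+-identityˡ _ ⟩
  ∑< L g                                          ∎
  where
  after : ∀ i → i < N ∸ (c ℕ.+ L) → f (c ℕ.+ L ℕ.+ i) ≡ + 0
  after i i<N∸c+L = subst (λ k → f k ≡ + 0) (sym (ℕP.+-assoc c L i))
    (above (L ℕ.+ i) (ℕP.m≤m+n L i)
      (subst (_< N) (ℕP.+-assoc c L i)
        (subst (c ℕ.+ L ℕ.+ i <_) (ℕP.m+[n∸m]≡n c+L≤N) (ℕP.+-monoʳ-< (c ℕ.+ L) i<N∸c+L))))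

∑<-extend : (b a : ℕ) → b ≤ a → (f : ℕ → ℤ) → (∀ i → b ≤ i → i < a → f i ≡ + 0) → ∑< a f ≡ ∑< b f
∑<-extend b a b≤a f vanish =
  ∑<-window 0 b a f f b≤a (λ _ ()) (λ _ _ → refl) vanish

∑<-reverse : (n : ℕ) (f : ℕ → ℤ) → ∑< n f ≡ ∑< n (λ i → f (n ∸ suc i))
∑<-reverse zero    f = refl
∑<-reverse (suc n) f = begin
  ∑< (suc n) f                                      ≡⟨ ∑<-sucˡ n f ⟩
  f 0 + ∑< n (f ∘ suc)                              ≡⟨ cong (_+_ (f 0)) (∑<-reverse n (f ∘ suc)) ⟩
  f 0 + ∑< n (λ i → f (suc (n ∸ suc i)))            ≡⟨ cong (_+_ (f 0)) (∑<-cong n (λ i i<n → cong f (ℕP.+-∸-assoc 1 i<n))) ⟨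
  f 0 + ∑< n (λ i → f (n ∸ i))                      ≡⟨ ℤP.+-comm (f 0) _ ⟩
  ∑< n (λ i → f (n ∸ i)) + f 0                      ≡⟨ cong (λ k → ∑< n (λ i → f (n ∸ i)) + f k) (ℕP.n∸n≡0 n) ⟨
  ∑< n (λ i → f (suc n ∸ suc i)) + f (n ∸ n)        ≡⟨ ∑<-sucʳ n (λ i → f (suc n ∸ suc i)) ⟨
  ∑< (suc n) (λ i → f (suc n ∸ suc i))              ∎

∑<-triangle : (N : ℕ) (F : ℕ → ℕ → ℤ) →
              ∑< N (λ i → ∑< (suc i) (F i)) ≡ ∑< N (λ j → ∑< (N ∸ j) (λ k → F (j ℕ.+ k) j))
∑<-triangle zero    F = refl
∑<-triangle (suc N) F = begin
  ∑< (suc N) (λ i → ∑< (suc i) (F i))                     ≡⟨ ∑<-sucʳ N _ ⟩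
  ∑< N (λ i → ∑< (suc i) (F i)) + ∑< (suc N) (F N)        ≡⟨ cong (_+ ∑< (suc N) (F N)) (trans (∑<-triangle N F) (sym dropEmpty)) ⟩
  ∑< (suc N) (λ j → ∑< (N ∸ j) (G j)) + ∑< (suc N) (F N)  ≡⟨ ∑-+ (λ j → ∑< (N ∸ j) (G j)) (F N) (upTo (suc N)) ⟨
  ∑< (suc N) (λ j → ∑< (N ∸ j) (G j) + F N j)             ≡⟨ ∑<-cong (suc N) grow ⟩
  ∑< (suc N) (λ j → ∑< (suc N ∸ j) (G j))                 ∎
  where
  G : ℕ → ℕ → ℤ
  G j k = F (j ℕ.+ k) j
  dropEmpty : ∑< (suc N) (λ j → ∑< (N ∸ j) (G j)) ≡ ∑< N (λ j → ∑< (N ∸ j) (G j))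
  dropEmpty = trans (∑<-sucʳ N _)
    (trans (cong (λ m → ∑< N (λ j → ∑< (N ∸ j) (G j)) + ∑< m (G N)) (ℕP.n∸n≡0 N)) (ℤP.+-identityʳ _))
  grow : ∀ j → j < suc N → ∑< (N ∸ j) (G j) + F N j ≡ ∑< (suc N ∸ j) (G j)
  grow j (s≤s j≤N) = begin
    ∑< (N ∸ j) (G j) + F N j          ≡⟨ cong (λ i → ∑< (N ∸ j) (G j) + F i j) (ℕP.m+[n∸m]≡n j≤N) ⟨
    ∑< (N ∸ j) (G j) + G j (N ∸ j)    ≡⟨ ∑<-sucʳ (N ∸ j) (G j) ⟨
    ∑< (suc (N ∸ j)) (G j)            ≡⟨ cong (λ m → ∑< m (G j)) (ℕP.+-∸-assoc 1 j≤N) ⟨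
    ∑< (suc N ∸ j) (G j)              ∎

𝟙 : {P : Set} → Dec P → ℤ
𝟙 (yes _) = + 1
𝟙 (no _)  = + 0

module _ {P : Set} where

  𝟙-yes : (p : Dec P) → P → 𝟙 p ≡ + 1
  𝟙-yes (yes _) _  = refl
  𝟙-yes (no ¬p) pf = ⊥-elim (¬p pf)

  𝟙-no : (p : Dec P) → ¬ P → 𝟙 p ≡ + 0
  𝟙-no (yes pf) ¬p = ⊥-elim (¬p pf)
  𝟙-no (no _)   _  = refl

  𝟙-cong : {Q : Set} (p : Dec P) (q : Dec Q) → (P → Q) → (Q → P) → 𝟙 p ≡ 𝟙 q
  𝟙-cong (yes _)  (yes _)  _ _ = refl
  𝟙-cong (no _)   (no _)   _ _ = refl
  𝟙-cong (yes pf) (no ¬q)  f _ = ⊥-elim (¬q (f pf))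
  𝟙-cong (no ¬p)  (yes qf) _ g = ⊥-elim (¬p (g qf))

  𝟙-× : {Q : Set} (p : Dec P) (q : Dec Q) → 𝟙 (p ×-dec q) ≡ 𝟙 p * 𝟙 q
  𝟙-× (yes _) (yes _) = refl
  𝟙-× (yes _) (no _)  = refl
  𝟙-× (no _)  (yes _) = refl
  𝟙-× (no _)  (no _)  = refl

  𝟙-*-cong : (p : Dec P) {a b : ℤ} → (P → a ≡ b) → 𝟙 p * a ≡ 𝟙 p * b
  𝟙-*-cong (yes pf) a≡b = cong (+ 1 *_) (a≡b pf)
  𝟙-*-cong (no _)   _   = refl

𝟙-+-≡ : (a b r : ℕ) → 𝟙 (a ℕ.+ b ℕ.≟ r) ≡ 𝟙 (a ≤? r) * 𝟙 (b ℕ.≟ r ∸ a)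
𝟙-+-≡ a b r with a ≤? r
... | yes a≤r = trans (𝟙-cong (a ℕ.+ b ℕ.≟ r) (b ℕ.≟ r ∸ a)
                   (λ a+b≡r → trans (sym (ℕP.m+n∸m≡n a b)) (cong (_∸ a) a+b≡r))
                   (λ b≡r∸a → trans (cong (a ℕ.+_) b≡r∸a) (ℕP.m+[n∸m]≡n a≤r)))
                  (sym (ℤP.*-identityˡ _))
... | no a≰r = 𝟙-no (a ℕ.+ b ℕ.≟ r) (λ a+b≡r → a≰r (subst (a ≤_) a+b≡r (ℕP.m≤m+n a b)))

∑<-delta : (L j : ℕ) (f : ℕ → ℤ) → ∑< L (λ r → 𝟙 (j ℕ.≟ r) * f r) ≡ 𝟙 (j <? L) * f j
∑<-delta zero    j f = refl
∑<-delta (suc L) j f = begin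
  ∑< (suc L) (λ r → 𝟙 (j ℕ.≟ r) * f r)            ≡⟨ ∑<-sucʳ L _ ⟩
  ∑< L (λ r → 𝟙 (j ℕ.≟ r) * f r) + 𝟙 (j ℕ.≟ L) * f L ≡⟨ cong (_+ 𝟙 (j ℕ.≟ L) * f L) (∑<-delta L j f) ⟩
  𝟙 (j <? L) * f j + 𝟙 (j ℕ.≟ L) * f L              ≡⟨ lastStep (ℕP.<-cmp j L) ⟩
  𝟙 (j <? suc L) * f j                             ∎
  where
  lastStep : Tri (j < L) (j ≡ L) (L < j) → 𝟙 (j <? L) * f j + 𝟙 (j ℕ.≟ L) * f L ≡ 𝟙 (j <? suc L) * f j
  lastStep (tri< j<L j≢L _) rewrite 𝟙-yes (j <? L) j<L | 𝟙-no (j ℕ.≟ L) j≢L | 𝟙-yes (j <? suc L) (ℕP.m<n⇒m<1+n j<L) =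
    ℤP.+-identityʳ _
  lastStep (tri≈ j≮L refl _) rewrite 𝟙-no (j <? L) j≮L | 𝟙-yes (j ℕ.≟ L) refl | 𝟙-yes (j <? suc L) ℕP.≤-refl =
    ℤP.+-identityˡ _
  lastStep (tri> j≮L j≢L L<j) rewrite 𝟙-no (j <? L) j≮L | 𝟙-no (j ℕ.≟ L) j≢L | 𝟙-no (j <? suc L) (ℕP.<⇒≱ L<j ∘ ℕP.≤-pred) =
    refl

∑<-𝟙-unique : (t : ℕ) {P : ℕ → Set} (P? : ∀ j → Dec (P j)) {Q : Set} (Q? : Dec Q) →
              Q ⇔ (∃ λ j → j < t × P j) → (∀ {j j′} → j < t → j′ < t → P j → P j′ → j ≡ j′) →
              ∑< t (𝟙 ∘ P?) ≡ 𝟙 Q?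
∑<-𝟙-unique t P? (no ¬q) Q⇔∃ unique =
  ∑<-zero t (λ j j<t → 𝟙-no (P? j) (λ pj → ¬q (Equivalence.from Q⇔∃ (j , j<t , pj))))
∑<-𝟙-unique t P? (yes q) Q⇔∃ unique with Equivalence.to Q⇔∃ q
... | j₀ , j₀<t , pj₀ = begin
  ∑< t (𝟙 ∘ P?)                      ≡⟨ ∑<-cong t (λ j j<t → trans (𝟙-cong (P? j) (j₀ ℕ.≟ j) (unique j₀<t j<t pj₀) (λ { refl → pj₀ }))
                                                                    (sym (ℤP.*-identityʳ _))) ⟩
  ∑< t (λ j → 𝟙 (j₀ ℕ.≟ j) * + 1)    ≡⟨ ∑<-delta t j₀ (λ _ → + 1) ⟩
  𝟙 (j₀ <? t) * + 1                  ≡⟨ cong (_* + 1) (𝟙-yes (j₀ <? t) j₀<t) ⟩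
  + 1                                ∎

length-filter : {A : Set} {P : Pred A _} (P? : Decidable P) (xs : List A) → + length (filter P? xs) ≡ ∑ (𝟙 ∘ P?) xs
length-filter P? []       = refl
length-filter P? (x ∷ xs) with P? x
... | yes _ = trans (ℤP.pos-+ 1 (length (filter P? xs))) (cong (_+_ (+ 1)) (length-filter P? xs))
... | no  _ = trans (length-filter P? xs) (sym (ℤP.+-identityˡ _))

∑<-interval : (lo hi N : ℕ) (f : ℕ → ℤ) → 1 ≤ lo → lo ≤ hi → hi ≤ N →
              ∑< N (λ x → 𝟙 ((lo ≤? suc x) ×-dec (suc x ≤? hi)) * f (suc x)) ≡ ∑< (suc (hi ∸ lo)) (λ i → f (lo ℕ.+ i))
∑<-interval (suc c) hi N f _ lo≤hi hi≤N =
  ∑<-window c (suc (hi ∸ suc c)) N _ (λ i → f (suc c ℕ.+ i)) window≤N below inside above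
  where
  lo : ℕ
  lo = suc c
  window≤N : c ℕ.+ suc (hi ∸ lo) ≤ N
  window≤N = subst (_≤ N) (sym (trans (ℕP.+-suc c (hi ∸ lo)) (ℕP.m+[n∸m]≡n lo≤hi))) hi≤N
  below : ∀ x → x < c → 𝟙 ((lo ≤? suc x) ×-dec (suc x ≤? hi)) * f (suc x) ≡ + 0
  below x x<c = cong (_* f (suc x)) (𝟙-no ((lo ≤? suc x) ×-dec (suc x ≤? hi)) (λ (lo≤1+x , _) → ℕP.<⇒≱ x<c (ℕP.≤-pred lo≤1+x)))
  inside : ∀ i → i < suc (hi ∸ lo) → 𝟙 ((lo ≤? lo ℕ.+ i) ×-dec (lo ℕ.+ i ≤? hi)) * f (lo ℕ.+ i) ≡ f (lo ℕ.+ i)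
  inside i (s≤s i≤hi∸lo) = trans
    (cong (_* f (lo ℕ.+ i)) (𝟙-yes ((lo ≤? lo ℕ.+ i) ×-dec (lo ℕ.+ i ≤? hi))
      (ℕP.m≤m+n lo i , subst (lo ℕ.+ i ≤_) (ℕP.m+[n∸m]≡n lo≤hi) (ℕP.+-monoʳ-≤ lo i≤hi∸lo))))
    (ℤP.*-identityˡ _)
  above : ∀ i → suc (hi ∸ lo) ≤ i → c ℕ.+ i < N → 𝟙 ((lo ≤? lo ℕ.+ i) ×-dec (lo ℕ.+ i ≤? hi)) * f (lo ℕ.+ i) ≡ + 0
  above i hi∸lo<i _ = cong (_* f (lo ℕ.+ i)) (𝟙-no ((lo ≤? lo ℕ.+ i) ×-dec (lo ℕ.+ i ≤? hi))
    (λ (_ , lo+i≤hi) → ℕP.<⇒≱ hi∸lo<i (subst (_≤ hi ∸ lo) (ℕP.m+n∸m≡n lo i) (ℕP.∸-monoˡ-≤ lo lo+i≤hi))))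

-- The ring of formal power series

⊛-cong : {f f′ g g′ : Series} → f ≗ f′ → g ≗ g′ → f ⊛ g ≗ f′ ⊛ g′
⊛-cong f≗f′ g≗g′ n = ∑-cong (λ i → cong₂ _*_ (f≗f′ i) (g≗g′ (n ∸ i))) (upTo (suc n))

⊛-congˡ : {f f′ : Series} (g : Series) → f ≗ f′ → f ⊛ g ≗ f′ ⊛ g
⊛-congˡ g f≗f′ n = ∑-cong (λ i → cong (_* g (n ∸ i)) (f≗f′ i)) (upTo (suc n))

⊛-congʳ : (f : Series) {g g′ : Series} → g ≗ g′ → f ⊛ g ≗ f ⊛ g′
⊛-congʳ f g≗g′ n = ∑-cong (λ i → cong (f i *_) (g≗g′ (n ∸ i))) (upTo (suc n))

⊛-cong-≤ : {f f′ : Series} (g : Series) (d : ℕ) → (∀ i → i ≤ d → f i ≡ f′ i) → (f ⊛ g) d ≡ (f′ ⊛ g) d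
⊛-cong-≤ g d f≡f′ = ∑<-cong (suc d) (λ i i≤d → cong (_* g (d ∸ i)) (f≡f′ i (ℕP.≤-pred i≤d)))

⊛-comm : (f g : Series) → f ⊛ g ≗ g ⊛ f
⊛-comm f g n = begin
  ∑< (suc n) (λ i → f i * g (n ∸ i))              ≡⟨ ∑<-reverse (suc n) (λ i → f i * g (n ∸ i)) ⟩
  ∑< (suc n) (λ i → f (n ∸ i) * g (n ∸ (n ∸ i)))  ≡⟨ ∑<-cong (suc n) (λ i i≤n → trans
                                                       (cong (λ k → f (n ∸ i) * g k) (ℕP.m∸[m∸n]≡n (ℕP.≤-pred i≤n)))
                                                       (ℤP.*-comm (f (n ∸ i)) (g i))) ⟩
  ∑< (suc n) (λ i → g i * f (n ∸ i))              ∎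

⊛-assoc : (f g h : Series) → (f ⊛ g) ⊛ h ≗ f ⊛ (g ⊛ h)
⊛-assoc f g h n = begin
  ∑< (suc n) (λ i → ∑< (suc i) (λ j → f j * g (i ∸ j)) * h (n ∸ i))
    ≡⟨ ∑-cong (λ i → ∑-*ʳ (h (n ∸ i)) (λ j → f j * g (i ∸ j)) (upTo (suc i))) (upTo (suc n)) ⟩
  ∑< (suc n) (λ i → ∑< (suc i) (λ j → f j * g (i ∸ j) * h (n ∸ i)))
    ≡⟨ ∑<-triangle (suc n) (λ i j → f j * g (i ∸ j) * h (n ∸ i)) ⟩
  ∑< (suc n) (λ j → ∑< (suc n ∸ j) (λ k → f j * g (j ℕ.+ k ∸ j) * h (n ∸ (j ℕ.+ k))))
    ≡⟨ ∑<-cong (suc n) (λ j j≤n → ∑<-cong (suc n ∸ j) (λ k _ → trans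
         (cong₂ (λ a b → f j * g a * h b) (ℕP.m+n∸m≡n j k) (sym (ℕP.∸-+-assoc n j k)))
         (ℤP.*-assoc (f j) (g k) _))) ⟩
  ∑< (suc n) (λ j → ∑< (suc n ∸ j) (λ k → f j * (g k * h (n ∸ j ∸ k))))
    ≡⟨ ∑<-cong (suc n) (λ j j≤n → trans
         (cong (λ m → ∑< m (λ k → f j * (g k * h (n ∸ j ∸ k)))) (ℕP.+-∸-assoc 1 (ℕP.≤-pred j≤n)))
         (sym (∑-*ˡ (f j) (λ k → g k * h (n ∸ j ∸ k)) (upTo (suc (n ∸ j)))))) ⟩
  ∑< (suc n) (λ j → f j * ∑< (suc (n ∸ j)) (λ k → g k * h (n ∸ j ∸ k)))
    ∎

⊛-distribˡ : (f g h : Series) → f ⊛ (g ⊕ h) ≗ (f ⊛ g) ⊕ (f ⊛ h)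
⊛-distribˡ f g h n = trans (∑-cong (λ i → ℤP.*-distribˡ-+ (f i) (g (n ∸ i)) (h (n ∸ i))) (upTo (suc n)))
                           (∑-+ (λ i → f i * g (n ∸ i)) (λ i → f i * h (n ∸ i)) (upTo (suc n)))

⊛-distribʳ : (f g h : Series) → (g ⊕ h) ⊛ f ≗ (g ⊛ f) ⊕ (h ⊛ f)
⊛-distribʳ f g h n = trans (⊛-comm (g ⊕ h) f n) (trans (⊛-distribˡ f g h n) (cong₂ _+_ (⊛-comm f g n) (⊛-comm f h n)))

⊛-identityˡ : (f : Series) → oneS ⊛ f ≗ f
⊛-identityˡ f n = begin
  ∑< (suc n) (λ i → mono 0 i * f (n ∸ i))                   ≡⟨ ∑<-sucˡ n (λ i → mono 0 i * f (n ∸ i)) ⟩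
  + 1 * f n + ∑< n (λ i → mono 0 (suc i) * f (n ∸ suc i))   ≡⟨ cong₂ _+_ (ℤP.*-identityˡ (f n)) (∑<-zero n (λ i _ → ℤP.*-zeroˡ (f (n ∸ suc i)))) ⟩
  f n + + 0                                                 ≡⟨ ℤP.+-identityʳ (f n) ⟩
  f n                                                       ∎

⊛-identityʳ : (f : Series) → f ⊛ oneS ≗ f
⊛-identityʳ f n = trans (⊛-comm f oneS n) (⊛-identityˡ f n)

seriesRing : CommutativeRing 0ℓ 0ℓ
seriesRing = record
  { Carrier = Series ; _≈_ = _≗_ ; _+_ = _⊕_ ; _*_ = _⊛_ ; -_ = λ f n → - f n ; 0# = zeroS ; 1# = oneS
  ; isCommutativeRing = record
    { isRing = record
      { +-isAbelianGroup = record
        { isGroup = record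
          { isMonoid = record
            { isSemigroup = record
              { isMagma = record
                { isEquivalence = Setoid.isEquivalence (ℕ →-setoid ℤ)
                ; ∙-cong = λ f≗f′ g≗g′ n → cong₂ _+_ (f≗f′ n) (g≗g′ n) }
              ; assoc = λ f g h n → ℤP.+-assoc (f n) (g n) (h n) }
            ; identity = (λ f n → ℤP.+-identityˡ (f n)) , (λ f n → ℤP.+-identityʳ (f n)) }
          ; inverse = (λ f n → ℤP.+-inverseˡ (f n)) , (λ f n → ℤP.+-inverseʳ (f n))
          ; ⁻¹-cong = λ f≗g n → cong -_ (f≗g n) }
        ; comm = λ f g n → ℤP.+-comm (f n) (g n) }
      ; *-cong = ⊛-cong
      ; *-assoc = ⊛-assoc
      ; *-identity = ⊛-identityˡ , ⊛-identityʳ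
      ; distrib = ⊛-distribˡ , ⊛-distribʳ }
    ; *-comm = ⊛-comm } }

-- Defined by cases so that the solver's constant 1 is definitionally oneS.
constant : ℤ → Series
constant (+ 1) = oneS
constant a     = λ n → a * oneS n

constant-≗ : (a : ℤ) → constant a ≗ λ n → a * oneS n
constant-≗ (+ 0)           n = refl
constant-≗ (+ 1)           n = sym (ℤP.*-identityˡ (oneS n))
constant-≗ (+ suc (suc k)) n = refl
constant-≗ -[1+ k ]        n = refl

constant-homomorphism : CommutativeRing.rawRing ℤP.+-*-commutativeRing
                          -Raw-AlmostCommutative⟶ fromCommutativeRing seriesRing
constant-homomorphism = record
  { ⟦_⟧    = constant
  ; +-homo = λ a b n → trans (constant-≗ (a + b) n)
                        (trans (ℤP.*-distribʳ-+ (oneS n) a b) (sym (cong₂ _+_ (constant-≗ a n) (constant-≗ b n))))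
  ; *-homo = *-homo
  ; -‿homo = λ a n → trans (constant-≗ (- a) n)
                        (trans (sym (ℤP.neg-distribˡ-* a (oneS n))) (sym (cong -_ (constant-≗ a n))))
  ; 0-homo = λ n → ℤP.*-zeroˡ (oneS n)
  ; 1-homo = λ n → refl }
  where
  *-homo : ∀ a b → constant (a * b) ≗ constant a ⊛ constant b
  *-homo a b n = begin
    constant (a * b) n
      ≡⟨ constant-≗ (a * b) n ⟩
    a * b * oneS n
      ≡⟨ ℤP.+-identityʳ _ ⟨
    a * b * oneS n + + 0
      ≡⟨ cong₂ _+_ (trans (ℤP.*-assoc a b (oneS n)) (cong (_* (b * oneS n)) (sym (ℤP.*-identityʳ a))))
                   (sym (∑<-zero n (λ i _ → cong (_* (b * oneS (n ∸ suc i))) (ℤP.*-zeroʳ a)))) ⟩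
    a * + 1 * (b * oneS n) + ∑< n (λ i → a * + 0 * (b * oneS (n ∸ suc i)))
      ≡⟨ ∑<-sucˡ n (λ i → a * oneS i * (b * oneS (n ∸ i))) ⟨
    ∑< (suc n) (λ i → a * oneS i * (b * oneS (n ∸ i)))
      ≡⟨ ⊛-cong (λ i → sym (constant-≗ a i)) (λ i → sym (constant-≗ b i)) n ⟩
    (constant a ⊛ constant b) n ∎

open Algebra.Solver.Ring (CommutativeRing.rawRing ℤP.+-*-commutativeRing)
  (fromCommutativeRing seriesRing) constant-homomorphism
  (λ a b → Maybe.map (λ a≡b n → cong (λ c → constant c n) a≡b) (dec⇒maybe (a ℤ.≟ b)))
  using (_:+_; _:*_; _:-_; _:=_; con; solve)

-- Monomials, q-Pochhammer symbols and Gaussian binomial coefficients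

mono-𝟙 : (e n : ℕ) → mono e n ≡ 𝟙 (e ℕ.≟ n)
mono-𝟙 e n with e ℕ.≟ n
... | yes _ = refl
... | no _  = refl

mono-suc : (e n : ℕ) → mono (suc e) (suc n) ≡ mono e n
mono-suc e n = begin
  mono (suc e) (suc n)       ≡⟨ mono-𝟙 (suc e) (suc n) ⟩
  𝟙 (suc e ℕ.≟ suc n)        ≡⟨ 𝟙-cong (suc e ℕ.≟ suc n) (e ℕ.≟ n) ℕP.suc-injective (cong suc) ⟩
  𝟙 (e ℕ.≟ n)                ≡⟨ mono-𝟙 e n ⟨
  mono e n                   ∎

mono-⊛ : (e n : ℕ) (f : Series) → (mono e ⊛ f) n ≡ 𝟙 (e ≤? n) * f (n ∸ e)
mono-⊛ zero    n       f = trans (⊛-identityˡ f n) (sym (ℤP.*-identityˡ (f n)))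
mono-⊛ (suc e) zero    f = refl
mono-⊛ (suc e) (suc n) f = begin
  (mono (suc e) ⊛ f) (suc n)
    ≡⟨ ∑<-sucˡ (suc n) (λ i → mono (suc e) i * f (suc n ∸ i)) ⟩
  mono (suc e) 0 * f (suc n) + ∑< (suc n) (λ i → mono (suc e) (suc i) * f (n ∸ i))
    ≡⟨ cong₂ _+_ (ℤP.*-zeroˡ (f (suc n))) (∑-cong (λ i → cong (_* f (n ∸ i)) (mono-suc e i)) (upTo (suc n))) ⟩
  + 0 + (mono e ⊛ f) n
    ≡⟨ ℤP.+-identityˡ _ ⟩
  (mono e ⊛ f) n
    ≡⟨ mono-⊛ e n f ⟩
  𝟙 (e ≤? n) * f (n ∸ e)
    ≡⟨ cong (_* f (n ∸ e)) (𝟙-cong (e ≤? n) (suc e ≤? suc n) s≤s ℕP.≤-pred) ⟩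
  𝟙 (suc e ≤? suc n) * f (suc n ∸ suc e)
    ∎

mono-⊛-≥ : (e n : ℕ) (f : Series) → e ≤ n → (mono e ⊛ f) n ≡ f (n ∸ e)
mono-⊛-≥ e n f e≤n = trans (mono-⊛ e n f) (trans (cong (_* f (n ∸ e)) (𝟙-yes (e ≤? n) e≤n)) (ℤP.*-identityˡ _))

mono-⊛-< : (e n : ℕ) (f : Series) → n < e → (mono e ⊛ f) n ≡ + 0
mono-⊛-< e n f n<e = trans (mono-⊛ e n f) (cong (_* f (n ∸ e)) (𝟙-no (e ≤? n) (ℕP.<⇒≱ n<e)))

mono-+ : (a b : ℕ) → mono a ⊛ mono b ≗ mono (a ℕ.+ b)
mono-+ a b n = begin
  (mono a ⊛ mono b) n                  ≡⟨ mono-⊛ a n (mono b) ⟩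
  𝟙 (a ≤? n) * mono b (n ∸ a)          ≡⟨ cong (𝟙 (a ≤? n) *_) (mono-𝟙 b (n ∸ a)) ⟩
  𝟙 (a ≤? n) * 𝟙 (b ℕ.≟ n ∸ a)         ≡⟨ 𝟙-+-≡ a b n ⟨
  𝟙 (a ℕ.+ b ℕ.≟ n)                    ≡⟨ mono-𝟙 (a ℕ.+ b) n ⟨
  mono (a ℕ.+ b) n                     ∎

mono-+-⊛ : (a b : ℕ) (f : Series) → mono a ⊛ (mono b ⊛ f) ≗ mono (a ℕ.+ b) ⊛ f
mono-+-⊛ a b f n = trans (sym (⊛-assoc (mono a) (mono b) f n)) (⊛-congˡ f (mono-+ a b) n)

geom-𝟙 : (i n : ℕ) → geom i n ≡ 𝟙 (n % suc i ℕ.≟ 0)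
geom-𝟙 i n with n % suc i ℕ.≟ 0
... | yes _ = refl
... | no _  = refl

geom-< : (i n : ℕ) → n < suc i → geom i n ≡ oneS n
geom-< i zero    _     = refl
geom-< i (suc n) n<1+i = trans (geom-𝟙 i (suc n))
  (𝟙-no (suc n % suc i ℕ.≟ 0) (λ r≡0 → ℕP.1+n≢0 (trans (sym (m<n⇒m%n≡m n<1+i)) r≡0)))

geom-unfold : (i : ℕ) → geom i ≗ oneS ⊕ (mono (suc i) ⊛ geom i)
geom-unfold i n with suc i ≤? n
... | yes i<n@(s≤s _) = begin
  geom i n                        ≡⟨ geom-𝟙 i n ⟩
  𝟙 (n % suc i ℕ.≟ 0)             ≡⟨ cong (λ r → 𝟙 (r ℕ.≟ 0)) (m≤n⇒[n∸m]%m≡n%m i<n) ⟨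
  𝟙 ((n ∸ suc i) % suc i ℕ.≟ 0)   ≡⟨ geom-𝟙 i (n ∸ suc i) ⟨
  geom i (n ∸ suc i)              ≡⟨ mono-⊛-≥ (suc i) n (geom i) i<n ⟨
  (mono (suc i) ⊛ geom i) n       ≡⟨ ℤP.+-identityˡ _ ⟨
  oneS n + (mono (suc i) ⊛ geom i) n ∎
... | no i≮n = begin
  geom i n                        ≡⟨ geom-< i n (ℕP.≰⇒> i≮n) ⟩
  oneS n                          ≡⟨ ℤP.+-identityʳ (oneS n) ⟨
  oneS n + + 0                    ≡⟨ cong (_+_ (oneS n)) (mono-⊛-< (suc i) n (geom i) (ℕP.≰⇒> i≮n)) ⟨
  oneS n + (mono (suc i) ⊛ geom i) n ∎

geom-inverse : (i : ℕ) → geom i ⊛ (oneS ⊖ mono (suc i)) ≗ oneS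
geom-inverse i n = begin
  (g ⊛ (oneS ⊖ q)) n                ≡⟨ solve 2 (λ g q → g :* (con (+ 1) :- q) := g :- q :* g) (λ _ → refl) g q n ⟩
  (g ⊖ (q ⊛ g)) n                   ≡⟨ cong (_- (q ⊛ g) n) (geom-unfold i n) ⟩
  ((oneS ⊕ (q ⊛ g)) ⊖ (q ⊛ g)) n    ≡⟨ solve 2 (λ u x → u :+ x :- x := u) (λ _ → refl) oneS (q ⊛ g) n ⟩
  oneS n                            ∎
  where
  g : Series
  g = geom i
  q : Series
  q = mono (suc i)

invPoch-inverse : (m : ℕ) → invPoch m ⊛ poch m ≗ oneS
invPoch-inverse zero    = ⊛-identityˡ oneS
invPoch-inverse (suc m) n = begin
  ((I ⊛ g) ⊛ (P ⊛ d)) n   ≡⟨ solve 4 (λ I g P d → (I :* g) :* (P :* d) := (I :* P) :* (g :* d)) (λ _ → refl) I g P d n ⟩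
  ((I ⊛ P) ⊛ (g ⊛ d)) n   ≡⟨ ⊛-cong (invPoch-inverse m) (geom-inverse m) n ⟩
  (oneS ⊛ oneS) n         ≡⟨ ⊛-identityˡ oneS n ⟩
  oneS n                  ∎
  where
  I : Series
  I = invPoch m
  g : Series
  g = geom m
  P : Series
  P = poch m
  d : Series
  d = oneS ⊖ mono (suc m)

poch-inverse : (m : ℕ) → poch m ⊛ invPoch m ≗ oneS
poch-inverse m n = trans (⊛-comm (poch m) (invPoch m) n) (invPoch-inverse m n)

invPoch-suc : (m : ℕ) → invPoch (suc m) ⊛ (oneS ⊖ mono (suc m)) ≗ invPoch m
invPoch-suc m n = begin
  ((invPoch m ⊛ geom m) ⊛ d) n   ≡⟨ ⊛-assoc (invPoch m) (geom m) d n ⟩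
  (invPoch m ⊛ (geom m ⊛ d)) n   ≡⟨ ⊛-congʳ (invPoch m) (geom-inverse m) n ⟩
  (invPoch m ⊛ oneS) n           ≡⟨ ⊛-identityʳ (invPoch m) n ⟩
  invPoch m n                    ∎
  where
  d : Series
  d = oneS ⊖ mono (suc m)

gaussian : ℕ → ℕ → Series
gaussian j H = qbinom (j ℕ.+ H) j

gaussian-unfold : (j H : ℕ) → gaussian j H ≗ poch (j ℕ.+ H) ⊛ invPoch j ⊛ invPoch H
gaussian-unfold j H n = cong (λ k → (poch (j ℕ.+ H) ⊛ invPoch j ⊛ invPoch k) n) (ℕP.m+n∸m≡n j H)

gaussian-comm : (j H : ℕ) → gaussian j H ≗ gaussian H j
gaussian-comm j H n = begin
  gaussian j H n                                 ≡⟨ gaussian-unfold j H n ⟩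
  (poch (j ℕ.+ H) ⊛ invPoch j ⊛ invPoch H) n     ≡⟨ cong (λ k → (poch k ⊛ invPoch j ⊛ invPoch H) n) (ℕP.+-comm j H) ⟩
  (poch (H ℕ.+ j) ⊛ invPoch j ⊛ invPoch H) n     ≡⟨ solve 3 (λ P a b → P :* a :* b := P :* b :* a) (λ _ → refl)
                                                         (poch (H ℕ.+ j)) (invPoch j) (invPoch H) n ⟩
  (poch (H ℕ.+ j) ⊛ invPoch H ⊛ invPoch j) n     ≡⟨ gaussian-unfold H j n ⟨
  gaussian H j n                                 ∎

gaussian-zeroˡ : (H : ℕ) → gaussian 0 H ≗ oneS
gaussian-zeroˡ H n = trans (⊛-congˡ (invPoch H) (⊛-identityʳ (poch H)) n) (poch-inverse H n)

gaussian-zeroʳ : (j : ℕ) → gaussian j 0 ≗ oneS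
gaussian-zeroʳ j n = trans (gaussian-comm j 0 n) (gaussian-zeroˡ j n)

gaussian-pascal : (j H : ℕ) → gaussian (suc j) (suc H) ≗ gaussian (suc j) H ⊕ (mono (suc H) ⊛ gaussian j (suc H))
gaussian-pascal j H n = begin
  gaussian (suc j) (suc H) n
    ≡⟨ gaussian-unfold (suc j) (suc H) n ⟩
  ((P ⊛ (oneS ⊖ mono (suc (j ℕ.+ suc H)))) ⊛ I ⊛ I′) n
    ≡⟨ ⊛-congˡ I′ (⊛-congˡ I (⊛-congʳ P (λ r → cong (_-_ (oneS r)) (sym (x⊛y r))))) n ⟩
  ((P ⊛ (oneS ⊖ (x H ⊛ x j))) ⊛ I ⊛ I′) n
    ≡⟨ solve 5 (λ P x y I I′ → P :* (con (+ 1) :- x :* y) :* I :* I′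
                               := P :* I :* (I′ :* (con (+ 1) :- x)) :+ x :* (P :* (I :* (con (+ 1) :- y)) :* I′))
               (λ _ → refl) P (x H) (x j) I I′ n ⟩
  (P ⊛ I ⊛ (I′ ⊛ (oneS ⊖ x H))) n + (x H ⊛ (P ⊛ (I ⊛ (oneS ⊖ x j)) ⊛ I′)) n
    ≡⟨ cong₂ _+_ (⊛-congʳ (P ⊛ I) (invPoch-suc H) n) (⊛-congʳ (x H) (⊛-congˡ I′ (⊛-congʳ P (invPoch-suc j))) n) ⟩
  (P ⊛ I ⊛ invPoch H) n + (x H ⊛ (P ⊛ invPoch j ⊛ I′)) n
    ≡⟨ cong₂ _+_ (trans (cong (λ k → (poch k ⊛ I ⊛ invPoch H) n) (ℕP.+-suc j H)) (sym (gaussian-unfold (suc j) H n)))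
                 (⊛-congʳ (x H) (λ r → sym (gaussian-unfold j (suc H) r)) n) ⟩
  gaussian (suc j) H n + (mono (suc H) ⊛ gaussian j (suc H)) n
    ∎
  where
  x : ℕ → Series
  x k = mono (suc k)
  P : Series
  P = poch (j ℕ.+ suc H)
  I : Series
  I = invPoch (suc j)
  I′ : Series
  I′ = invPoch (suc H)
  x⊛y : x H ⊛ x j ≗ mono (suc (j ℕ.+ suc H))
  x⊛y r = trans (mono-+ (suc H) (suc j) r)
    (cong (λ k → mono (suc k) r) (trans (ℕP.+-suc H j) (trans (cong suc (ℕP.+-comm H j)) (sym (ℕP.+-suc j H)))))

pochFrom : ℕ → ℕ → Series
pochFrom H zero    = oneS
pochFrom H (suc j) = pochFrom H j ⊛ (oneS ⊖ mono (suc (H ℕ.+ j)))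

poch-+ : (H j : ℕ) → poch (H ℕ.+ j) ≗ poch H ⊛ pochFrom H j
poch-+ H zero    n = trans (cong (λ k → poch k n) (ℕP.+-identityʳ H)) (sym (⊛-identityʳ (poch H) n))
poch-+ H (suc j) n = begin
  poch (H ℕ.+ suc j) n                ≡⟨ cong (λ k → poch k n) (ℕP.+-suc H j) ⟩
  (poch (H ℕ.+ j) ⊛ d) n              ≡⟨ ⊛-congˡ d (poch-+ H j) n ⟩
  (poch H ⊛ pochFrom H j ⊛ d) n       ≡⟨ ⊛-assoc (poch H) (pochFrom H j) d n ⟩
  (poch H ⊛ (pochFrom H j ⊛ d)) n     ∎
  where
  d : Series
  d = oneS ⊖ mono (suc (H ℕ.+ j))

gaussian-pochFrom : (j H : ℕ) → gaussian j H ≗ invPoch j ⊛ pochFrom H j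
gaussian-pochFrom j H n = begin
  gaussian j H n                                          ≡⟨ gaussian-unfold j H n ⟩
  (poch (j ℕ.+ H) ⊛ invPoch j ⊛ invPoch H) n              ≡⟨ cong (λ k → (poch k ⊛ invPoch j ⊛ invPoch H) n) (ℕP.+-comm j H) ⟩
  (poch (H ℕ.+ j) ⊛ invPoch j ⊛ invPoch H) n              ≡⟨ ⊛-congˡ (invPoch H) (⊛-congˡ (invPoch j) (poch-+ H j)) n ⟩
  (poch H ⊛ pochFrom H j ⊛ invPoch j ⊛ invPoch H) n       ≡⟨ solve 4 (λ P R a b → P :* R :* a :* b := (P :* b) :* (a :* R))
                                                                (λ _ → refl) (poch H) (pochFrom H j) (invPoch j) (invPoch H) n ⟩
  ((poch H ⊛ invPoch H) ⊛ (invPoch j ⊛ pochFrom H j)) n   ≡⟨ ⊛-congˡ (invPoch j ⊛ pochFrom H j) (poch-inverse H) n ⟩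
  (oneS ⊛ (invPoch j ⊛ pochFrom H j)) n                   ≡⟨ ⊛-identityˡ (invPoch j ⊛ pochFrom H j) n ⟩
  (invPoch j ⊛ pochFrom H j) n                            ∎

pochFrom-≤ : (H j r : ℕ) → r ≤ H → pochFrom H j r ≡ oneS r
pochFrom-≤ H zero    r _   = refl
pochFrom-≤ H (suc j) r r≤H = begin
  (R ⊛ (oneS ⊖ m)) r    ≡⟨ solve 2 (λ R m → R :* (con (+ 1) :- m) := R :- m :* R) (λ _ → refl) R m r ⟩
  R r - (m ⊛ R) r       ≡⟨ cong₂ _-_ (pochFrom-≤ H j r r≤H) (mono-⊛-< (suc (H ℕ.+ j)) r R (s≤s (ℕP.≤-trans r≤H (ℕP.m≤m+n H j)))) ⟩
  oneS r - + 0          ≡⟨ ℤP.+-identityʳ (oneS r) ⟩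
  oneS r                ∎
  where
  R : Series
  R = pochFrom H j
  m : Series
  m = mono (suc (H ℕ.+ j))

gaussian-≤ : (j H r : ℕ) → r ≤ H → gaussian j H r ≡ invPoch j r
gaussian-≤ j H r r≤H = begin
  gaussian j H r                ≡⟨ gaussian-pochFrom j H r ⟩
  (invPoch j ⊛ pochFrom H j) r  ≡⟨ ∑<-cong (suc r) (λ i _ → cong (invPoch j i *_) (pochFrom-≤ H j (r ∸ i) (ℕP.≤-trans (ℕP.m∸n≤m r i) r≤H))) ⟩
  (invPoch j ⊛ oneS) r          ≡⟨ ⊛-identityʳ (invPoch j) r ⟩
  invPoch j r                   ∎

-- Generating functions of nonincreasing sequences

gf : {A : Set} → (A → ℤ) → (A → ℕ) → List A → Series
gf w size xs r = ∑ (λ a → w a * 𝟙 (size a ℕ.≟ r)) xs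

gf-shift : {A : Set} (e : ℕ) (w : A → ℤ) (size : A → ℕ) (xs : List A) →
           gf w (λ a → e ℕ.+ size a) xs ≗ mono e ⊛ gf w size xs
gf-shift e w size xs r = begin
  ∑ (λ a → w a * 𝟙 (e ℕ.+ size a ℕ.≟ r)) xs                    ≡⟨ ∑-cong (λ a → reorder (w a)) xs ⟩
  ∑ (λ a → 𝟙 (e ≤? r) * (w a * 𝟙 (size a ℕ.≟ r ∸ e))) xs        ≡⟨ ∑-*ˡ (𝟙 (e ≤? r)) _ xs ⟨
  𝟙 (e ≤? r) * gf w size xs (r ∸ e)                             ≡⟨ mono-⊛ e r (gf w size xs) ⟨
  (mono e ⊛ gf w size xs) r                                     ∎
  where
  reorder : ∀ {s} u → u * 𝟙 (e ℕ.+ s ℕ.≟ r) ≡ 𝟙 (e ≤? r) * (u * 𝟙 (s ℕ.≟ r ∸ e))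
  reorder {s} u = trans (cong (u *_) (𝟙-+-≡ e s r)) (ℤ*.x∙yz≈y∙xz u (𝟙 (e ≤? r)) _)

𝟙-+-≡-∑ : (a b n : ℕ) → 𝟙 (a ℕ.+ b ℕ.≟ n) ≡ ∑< (suc n) (λ r → 𝟙 (a ℕ.≟ r) * 𝟙 (b ℕ.≟ n ∸ r))
𝟙-+-≡-∑ a b n = sym (begin
  ∑< (suc n) (λ r → 𝟙 (a ℕ.≟ r) * 𝟙 (b ℕ.≟ n ∸ r))   ≡⟨ ∑<-delta (suc n) a (λ r → 𝟙 (b ℕ.≟ n ∸ r)) ⟩
  𝟙 (a <? suc n) * 𝟙 (b ℕ.≟ n ∸ a)                  ≡⟨ cong (_* 𝟙 (b ℕ.≟ n ∸ a)) (𝟙-cong (a <? suc n) (a ≤? n) ℕP.≤-pred s≤s) ⟩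
  𝟙 (a ≤? n) * 𝟙 (b ℕ.≟ n ∸ a)                      ≡⟨ 𝟙-+-≡ a b n ⟨
  𝟙 (a ℕ.+ b ℕ.≟ n)                                 ∎)

gf-product : {A B : Set} (v : A → ℤ) (s : A → ℕ) (xs : List A) (w : B → ℤ) (t : B → ℕ) (ys : List B) (n : ℕ) →
             ∑ (λ a → ∑ (λ b → v a * w b * 𝟙 (s a ℕ.+ t b ℕ.≟ n)) ys) xs ≡ (gf v s xs ⊛ gf w t ys) n
gf-product v s xs w t ys n = begin
  ∑ (λ a → ∑ (λ b → v a * w b * 𝟙 (s a ℕ.+ t b ℕ.≟ n)) ys) xs
    ≡⟨ ∑-cong (λ a → ∑-cong (λ b → split a b) ys) xs ⟩
  ∑ (λ a → ∑ (λ b → ∑< (suc n) (λ r → v a * 𝟙 (s a ℕ.≟ r) * (w b * 𝟙 (t b ℕ.≟ n ∸ r)))) ys) xs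
    ≡⟨ ∑-product (suc n) (λ a r → v a * 𝟙 (s a ℕ.≟ r)) (λ b r → w b * 𝟙 (t b ℕ.≟ n ∸ r)) xs ys ⟩
  (gf v s xs ⊛ gf w t ys) n
    ∎
  where
  split : ∀ a b → v a * w b * 𝟙 (s a ℕ.+ t b ℕ.≟ n)
                ≡ ∑< (suc n) (λ r → v a * 𝟙 (s a ℕ.≟ r) * (w b * 𝟙 (t b ℕ.≟ n ∸ r)))
  split a b = trans (cong (v a * w b *_) (𝟙-+-≡-∑ (s a) (t b) n))
    (trans (∑-*ˡ (v a * w b) _ (upTo (suc n)))
      (∑-cong (λ r → ℤ*.interchange (v a) (w b) (𝟙 (s a ℕ.≟ r)) (𝟙 (t b ℕ.≟ n ∸ r))) (upTo (suc n))))

∑-listsOf-suc : (t N : ℕ) (w : List ℕ → ℤ) →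
                ∑ w (listsOf (suc t) N) ≡ ∑< N (λ x → ∑ (λ ys → w (suc x ∷ ys)) (listsOf t N))
∑-listsOf-suc t N w = begin
  ∑ w (concat (map (λ x → map (x ∷_) (listsOf t N)) (range 1 N)))
    ≡⟨ ∑-concatMap w (λ x → map (x ∷_) (listsOf t N)) (range 1 N) ⟩
  ∑ (λ x → ∑ w (map (x ∷_) (listsOf t N))) (range 1 N)
    ≡⟨ ∑-map (λ x → ∑ w (map (x ∷_) (listsOf t N))) suc (upTo N) ⟩
  ∑< N (λ x → ∑ w (map (suc x ∷_) (listsOf t N)))
    ≡⟨ ∑-cong (λ x → ∑-map w (suc x ∷_) (listsOf t N)) (upTo N) ⟩
  ∑< N (λ x → ∑ (λ ys → w (suc x ∷ ys)) (listsOf t N))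
    ∎

∑-listsOf-cong : (t N : ℕ) {f g : List ℕ → ℤ} → (∀ xs → length xs ≡ t → f xs ≡ g xs) →
                 ∑ f (listsOf t N) ≡ ∑ g (listsOf t N)
∑-listsOf-cong zero    N f≗g = cong (_+ + 0) (f≗g [] refl)
∑-listsOf-cong (suc t) N {f} {g} f≗g = begin
  ∑ f (listsOf (suc t) N)                              ≡⟨ ∑-listsOf-suc t N f ⟩
  ∑< N (λ x → ∑ (λ ys → f (suc x ∷ ys)) (listsOf t N))  ≡⟨ ∑-cong (λ x → ∑-listsOf-cong t N (λ ys len≡t → f≗g (suc x ∷ ys) (cong suc len≡t))) (upTo N) ⟩
  ∑< N (λ x → ∑ (λ ys → g (suc x ∷ ys)) (listsOf t N))  ≡⟨ ∑-listsOf-suc t N g ⟨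
  ∑ g (listsOf (suc t) N)                              ∎

∑-listsOf-+ : (j m N : ℕ) (w : List ℕ → ℤ) →
              ∑ w (listsOf (j ℕ.+ m) N) ≡ ∑ (λ ys → ∑ (λ zs → w (ys ++ zs)) (listsOf m N)) (listsOf j N)
∑-listsOf-+ zero    m N w = sym (ℤP.+-identityʳ _)
∑-listsOf-+ (suc j) m N w = begin
  ∑ w (listsOf (suc (j ℕ.+ m)) N)
    ≡⟨ ∑-listsOf-suc (j ℕ.+ m) N w ⟩
  ∑< N (λ x → ∑ (λ ys → w (suc x ∷ ys)) (listsOf (j ℕ.+ m) N))
    ≡⟨ ∑-cong (λ x → ∑-listsOf-+ j m N (λ ys → w (suc x ∷ ys))) (upTo N) ⟩
  ∑< N (λ x → ∑ (λ ys → ∑ (λ zs → w (suc x ∷ ys ++ zs)) (listsOf m N)) (listsOf j N))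
    ≡⟨ ∑-listsOf-suc j N (λ ys → ∑ (λ zs → w (ys ++ zs)) (listsOf m N)) ⟨
  ∑ (λ ys → ∑ (λ zs → w (ys ++ zs)) (listsOf m N)) (listsOf (suc j) N)
    ∎

NonincrBetween : ℕ → ℕ → List ℕ → Set
NonincrBetween lo hi []       = ⊤
NonincrBetween lo hi (y ∷ ys) = (lo ≤ y × y ≤ hi) × NonincrBetween lo y ys

nonincrBetween? : (lo hi : ℕ) (xs : List ℕ) → Dec (NonincrBetween lo hi xs)
nonincrBetween? lo hi []       = yes tt
nonincrBetween? lo hi (y ∷ ys) = ((lo ≤? y) ×-dec (y ≤? hi)) ×-dec nonincrBetween? lo y ys

nonincr𝟙 : ℕ → ℕ → List ℕ → ℤ
nonincr𝟙 lo hi xs = 𝟙 (nonincrBetween? lo hi xs)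

-- Recursion on the largest part lo + i of a nonincreasing sequence with parts in [lo, lo + H].
nonincrGF : ℕ → ℕ → ℕ → Series
nonincrGF zero    lo H   = oneS
nonincrGF (suc j) lo H r = ∑< (suc H) (λ i → (mono (lo ℕ.+ i) ⊛ nonincrGF j lo i) r)

gf-nonincr : (j lo hi N : ℕ) → 1 ≤ lo → lo ≤ hi → hi ≤ N →
             gf (nonincr𝟙 lo hi) sumℕ (listsOf j N) ≗ nonincrGF j lo (hi ∸ lo)
gf-nonincr zero    lo hi N _ _ _ r = trans (ℤP.+-identityʳ _) (trans (ℤP.*-identityˡ _) (sym (mono-𝟙 0 r)))
gf-nonincr (suc j) lo hi N 1≤lo lo≤hi hi≤N r = begin
  gf (nonincr𝟙 lo hi) sumℕ (listsOf (suc j) N) r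
    ≡⟨ ∑-listsOf-suc j N (λ ys → nonincr𝟙 lo hi ys * 𝟙 (sumℕ ys ℕ.≟ r)) ⟩
  ∑< N (λ x → ∑ (λ ys → nonincr𝟙 lo hi (suc x ∷ ys) * 𝟙 (suc x ℕ.+ sumℕ ys ℕ.≟ r)) (listsOf j N))
    ≡⟨ ∑-cong headFactor (upTo N) ⟩
  ∑< N (λ x → 𝟙 (head? x) * gf (nonincr𝟙 lo (suc x)) (λ ys → suc x ℕ.+ sumℕ ys) (listsOf j N) r)
    ≡⟨ ∑-cong (λ x → 𝟙-*-cong (head? x) (tail x)) (upTo N) ⟩
  ∑< N (λ x → 𝟙 (head? x) * (mono (suc x) ⊛ nonincrGF j lo (suc x ∸ lo)) r)
    ≡⟨ ∑<-interval lo hi N (λ y → (mono y ⊛ nonincrGF j lo (y ∸ lo)) r) 1≤lo lo≤hi hi≤N ⟩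
  ∑< (suc (hi ∸ lo)) (λ i → (mono (lo ℕ.+ i) ⊛ nonincrGF j lo (lo ℕ.+ i ∸ lo)) r)
    ≡⟨ ∑-cong (λ i → cong (λ k → (mono (lo ℕ.+ i) ⊛ nonincrGF j lo k) r) (ℕP.m+n∸m≡n lo i)) (upTo (suc (hi ∸ lo))) ⟩
  nonincrGF (suc j) lo (hi ∸ lo) r
    ∎
  where
  head? : (x : ℕ) → Dec (lo ≤ suc x × suc x ≤ hi)
  head? x = (lo ≤? suc x) ×-dec (suc x ≤? hi)
  headFactor : ∀ x → ∑ (λ ys → nonincr𝟙 lo hi (suc x ∷ ys) * 𝟙 (suc x ℕ.+ sumℕ ys ℕ.≟ r)) (listsOf j N)
                     ≡ 𝟙 (head? x) * gf (nonincr𝟙 lo (suc x)) (λ ys → suc x ℕ.+ sumℕ ys) (listsOf j N) r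
  headFactor x = trans
    (∑-cong (λ ys → trans (cong (_* 𝟙 (suc x ℕ.+ sumℕ ys ℕ.≟ r)) (𝟙-× (head? x) (nonincrBetween? lo (suc x) ys)))
                          (ℤP.*-assoc (𝟙 (head? x)) _ _)) (listsOf j N))
    (sym (∑-*ˡ (𝟙 (head? x)) _ (listsOf j N)))
  tail : ∀ x → lo ≤ suc x × suc x ≤ hi →
         gf (nonincr𝟙 lo (suc x)) (λ ys → suc x ℕ.+ sumℕ ys) (listsOf j N) r ≡ (mono (suc x) ⊛ nonincrGF j lo (suc x ∸ lo)) r
  tail x (lo≤1+x , 1+x≤hi) = trans (gf-shift (suc x) (nonincr𝟙 lo (suc x)) sumℕ (listsOf j N) r)
    (⊛-congʳ (mono (suc x)) (gf-nonincr j lo (suc x) N 1≤lo lo≤1+x (ℕP.≤-trans 1+x≤hi hi≤N)) r)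

nonincrGF-gaussian : (j lo H : ℕ) → nonincrGF j lo H ≗ mono (j ℕ.* lo) ⊛ gaussian j H
nonincrGF-gaussian zero    lo H r = sym (trans (⊛-identityˡ (gaussian 0 H) r) (gaussian-zeroˡ H r))
nonincrGF-gaussian (suc j) lo zero r = begin
  (mono (lo ℕ.+ 0) ⊛ nonincrGF j lo 0) r + + 0    ≡⟨ ℤP.+-identityʳ _ ⟩
  (mono (lo ℕ.+ 0) ⊛ nonincrGF j lo 0) r          ≡⟨ ⊛-cong (λ n → cong (λ k → mono k n) (ℕP.+-identityʳ lo)) (nonincrGF-gaussian j lo 0) r ⟩
  (mono lo ⊛ (mono (j ℕ.* lo) ⊛ gaussian j 0)) r  ≡⟨ mono-+-⊛ lo (j ℕ.* lo) (gaussian j 0) r ⟩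
  (mono (suc j ℕ.* lo) ⊛ gaussian j 0) r          ≡⟨ ⊛-congʳ (mono (suc j ℕ.* lo)) (λ n → trans (gaussian-zeroʳ j n) (sym (gaussian-zeroʳ (suc j) n))) r ⟩
  (mono (suc j ℕ.* lo) ⊛ gaussian (suc j) 0) r    ∎
nonincrGF-gaussian (suc j) lo (suc H) r = begin
  nonincrGF (suc j) lo (suc H) r
    ≡⟨ ∑<-sucʳ (suc H) (λ i → (mono (lo ℕ.+ i) ⊛ nonincrGF j lo i) r) ⟩
  nonincrGF (suc j) lo H r + (mono (lo ℕ.+ suc H) ⊛ nonincrGF j lo (suc H)) r
    ≡⟨ cong₂ _+_ (nonincrGF-gaussian (suc j) lo H r) (⊛-congʳ (mono (lo ℕ.+ suc H)) (nonincrGF-gaussian j lo (suc H)) r) ⟩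
  (M ⊛ gaussian (suc j) H) r + (mono (lo ℕ.+ suc H) ⊛ (mono (j ℕ.* lo) ⊛ gaussian j (suc H))) r
    ≡⟨ cong (_+_ ((M ⊛ gaussian (suc j) H) r)) reshift ⟩
  (M ⊛ gaussian (suc j) H) r + (M ⊛ (mono (suc H) ⊛ gaussian j (suc H))) r
    ≡⟨ ⊛-distribˡ M (gaussian (suc j) H) (mono (suc H) ⊛ gaussian j (suc H)) r ⟨
  (M ⊛ (gaussian (suc j) H ⊕ (mono (suc H) ⊛ gaussian j (suc H)))) r
    ≡⟨ ⊛-congʳ M (gaussian-pascal j H) r ⟨
  (M ⊛ gaussian (suc j) (suc H)) r
    ∎
  where
  M : Series
  M = mono (suc j ℕ.* lo)
  reshift : (mono (lo ℕ.+ suc H) ⊛ (mono (j ℕ.* lo) ⊛ gaussian j (suc H))) r ≡ (M ⊛ (mono (suc H) ⊛ gaussian j (suc H))) r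
  reshift = trans (mono-+-⊛ (lo ℕ.+ suc H) (j ℕ.* lo) (gaussian j (suc H)) r)
    (trans (cong (λ k → (mono k ⊛ gaussian j (suc H)) r) (ℕ+.xy∙z≈xz∙y lo (suc H) (j ℕ.* lo)))
           (sym (mono-+-⊛ (suc j ℕ.* lo) (suc H) (gaussian j (suc H)) r)))

-- Partitions and fixed hooks

nonincrBetween⁺ : {hi : ℕ} {xs : List ℕ} → All (0 <_) xs → Linked _≥_ (hi ∷ xs) → NonincrBetween 1 hi xs
nonincrBetween⁺ []          _             = tt
nonincrBetween⁺ (0<y ∷ 0<ys) (y≤hi ∷ linked) = (0<y , y≤hi) , nonincrBetween⁺ 0<ys linked

nonincrBetween⁻ : {lo hi : ℕ} (xs : List ℕ) → 1 ≤ lo → NonincrBetween lo hi xs → All (0 <_) xs × Linked _≥_ (hi ∷ xs)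
nonincrBetween⁻ []       _    _                           = [] , [-]
nonincrBetween⁻ (y ∷ ys) 1≤lo ((lo≤y , y≤hi) , nonincr-ys) =
  let 0<ys , linked = nonincrBetween⁻ ys 1≤lo nonincr-ys
  in ℕP.≤-trans 1≤lo lo≤y ∷ 0<ys , y≤hi ∷ linked

head≤sum : (xs : List ℕ) → Linked _≥_ xs → Linked _≥_ (sumℕ xs ∷ xs)
head≤sum []       _      = [-]
head≤sum (y ∷ ys) linked = ℕP.m≤m+n y (sumℕ ys) ∷ linked

isPartition⇔ : (n : ℕ) (xs : List ℕ) → IsPartition n xs ⇔ (NonincrBetween 1 n xs × sumℕ xs ≡ n)
isPartition⇔ n xs = mk⇔
  (λ (0<xs , linked , sum≡n) → nonincrBetween⁺ 0<xs (subst (λ s → Linked _≥_ (s ∷ xs)) sum≡n (head≤sum xs linked)) , sum≡n)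
  (λ (nonincr , sum≡n) → let 0<xs , linked = nonincrBetween⁻ xs ℕP.≤-refl nonincr in 0<xs , Linked.tail linked , sum≡n)

𝟙-isPartition : (n : ℕ) (xs : List ℕ) → 𝟙 (isPartition? n xs) ≡ nonincr𝟙 1 n xs * 𝟙 (sumℕ xs ℕ.≟ n)
𝟙-isPartition n xs = trans
  (𝟙-cong (isPartition? n xs) (nonincrBetween? 1 n xs ×-dec (sumℕ xs ℕ.≟ n))
          (Equivalence.to (isPartition⇔ n xs)) (Equivalence.from (isPartition⇔ n xs)))
  (𝟙-× (nonincrBetween? 1 n xs) (sumℕ xs ℕ.≟ n))

nonincrBetween-++⁻ : {lo hi x : ℕ} (ys : List ℕ) {zs : List ℕ} → NonincrBetween lo hi (ys ++ x ∷ zs) →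
                     NonincrBetween x hi ys × (lo ≤ x × x ≤ hi) × NonincrBetween lo x zs
nonincrBetween-++⁻ []       (x-bounds , nonincr-zs)      = tt , x-bounds , nonincr-zs
nonincrBetween-++⁻ (y ∷ ys) ((lo≤y , y≤hi) , nonincr-rest) =
  let nonincr-ys , (lo≤x , x≤y) , nonincr-zs = nonincrBetween-++⁻ ys nonincr-rest
  in ((x≤y , y≤hi) , nonincr-ys) , (lo≤x , ℕP.≤-trans x≤y y≤hi) , nonincr-zs

nonincrBetween-++⁺ : {lo hi x : ℕ} (ys : List ℕ) {zs : List ℕ} → NonincrBetween x hi ys → lo ≤ x → x ≤ hi →
                     NonincrBetween lo x zs → NonincrBetween lo hi (ys ++ x ∷ zs)
nonincrBetween-++⁺ []       _                             lo≤x x≤hi nonincr-zs = (lo≤x , x≤hi) , nonincr-zs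
nonincrBetween-++⁺ (y ∷ ys) ((x≤y , y≤hi) , nonincr-ys) lo≤x x≤hi nonincr-zs =
  (ℕP.≤-trans lo≤x x≤y , y≤hi) , nonincrBetween-++⁺ ys nonincr-ys lo≤x x≤y nonincr-zs

nonincr𝟙-++ : (lo hi x : ℕ) (ys zs : List ℕ) → lo ≤ x → x ≤ hi →
              nonincr𝟙 lo hi (ys ++ x ∷ zs) ≡ nonincr𝟙 x hi ys * nonincr𝟙 lo x zs
nonincr𝟙-++ lo hi x ys zs lo≤x x≤hi = trans
  (𝟙-cong (nonincrBetween? lo hi (ys ++ x ∷ zs)) (nonincrBetween? x hi ys ×-dec nonincrBetween? lo x zs)
          (λ nonincr → let nonincr-ys , _ , nonincr-zs = nonincrBetween-++⁻ ys nonincr in nonincr-ys , nonincr-zs)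
          (λ (nonincr-ys , nonincr-zs) → nonincrBetween-++⁺ ys nonincr-ys lo≤x x≤hi nonincr-zs))
  (𝟙-× (nonincrBetween? x hi ys) (nonincrBetween? lo x zs))

-- Out-of-range positions read as 0; only positions below the length are ever used.
lookupℕ : List ℕ → ℕ → ℕ
lookupℕ []       _       = 0
lookupℕ (y ∷ ys) zero    = y
lookupℕ (y ∷ ys) (suc j) = lookupℕ ys j

lookup-lookupℕ : (xs : List ℕ) (i : Fin (length xs)) → lookup xs i ≡ lookupℕ xs (toℕ i)
lookup-lookupℕ (x ∷ xs) Fin.zero    = refl
lookup-lookupℕ (x ∷ xs) (Fin.suc i) = lookup-lookupℕ xs i

lookupℕ-++ : (ys zs : List ℕ) (x : ℕ) → lookupℕ (ys ++ x ∷ zs) (length ys) ≡ x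
lookupℕ-++ []       zs x = refl
lookupℕ-++ (y ∷ ys) zs x = lookupℕ-++ ys zs x

lookupℕ-antitone : (xs : List ℕ) → Linked _≥_ xs → {j j′ : ℕ} → j ≤ j′ → j′ < length xs → lookupℕ xs j′ ≤ lookupℕ xs j
lookupℕ-antitone (y ∷ ys)     _                {zero}  {zero}   _         _           = ℕP.≤-refl
lookupℕ-antitone (y ∷ z ∷ zs) (z≤y ∷ linked) {zero}  {suc j′} _         (s≤s j′<)  =
  ℕP.≤-trans (lookupℕ-antitone (z ∷ zs) linked z≤n j′<) z≤y
lookupℕ-antitone (y ∷ z ∷ zs) (_ ∷ linked)   {suc j} {suc j′} (s≤s j≤j′) (s≤s j′<) =
  lookupℕ-antitone (z ∷ zs) linked j≤j′ j′<
lookupℕ-antitone (y ∷ [])     _                {_}     {suc j′} _         (s≤s ())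

-- hook1 λ i ≡ s + h for the 1-based row s = j + 1 (j = toℕ i), rearranged as λ_s + t ≡ 2s + h.
FixedHookAt : ℤ → List ℕ → ℕ → Set
FixedHookAt h xs j = + (lookupℕ xs j ℕ.+ length xs) ≡ + (suc j ℕ.+ suc j) + h

fixedHookAt? : (h : ℤ) (xs : List ℕ) (j : ℕ) → Dec (FixedHookAt h xs j)
fixedHookAt? h xs j = + (lookupℕ xs j ℕ.+ length xs) ℤ.≟ + (suc j ℕ.+ suc j) + h

-≡+⇔≡+ : (u s h : ℤ) → (u - s ≡ s + h) ⇔ (u ≡ (s + s) + h)
-≡+⇔≡+ u s h = mk⇔
  (λ eq → trans (u≡u-s+s u s) (trans (cong (_+ s) eq) (s+h+s≡s+s+h s h)))
  (λ eq → trans (cong (_- s) eq) (s+s+h-s≡s+h s h))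
  where
  u≡u-s+s : ∀ u s → u ≡ u - s + s
  u≡u-s+s = solve-∀
  s+h+s≡s+s+h : ∀ s h → s + h + s ≡ s + s + h
  s+h+s≡s+s+h = solve-∀
  s+s+h-s≡s+h : ∀ s h → s + s + h - s ≡ s + h
  s+s+h-s≡s+h = solve-∀

hook1⇔fixedHookAt : (h : ℤ) (xs : List ℕ) (i : Fin (length xs)) →
                    (hook1 xs i ≡ + suc (toℕ i) + h) ⇔ FixedHookAt h xs (toℕ i)
hook1⇔fixedHookAt h xs i = mk⇔
  (λ eq → trans (sym u≡) (trans (to eq) (cong (_+ h) s+s≡)))
  (λ eq → from (trans u≡ (trans eq (cong (_+ h) (sym s+s≡)))))
  where
  s : ℕ
  s = suc (toℕ i)
  open Equivalence (-≡+⇔≡+ (+ lookup xs i + + length xs) (+ s) h)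
  u≡ : + lookup xs i + + length xs ≡ + (lookupℕ xs (toℕ i) ℕ.+ length xs)
  u≡ = trans (cong (λ a → + a + + length xs) (lookup-lookupℕ xs i)) (sym (ℤP.pos-+ _ (length xs)))
  s+s≡ : + s + + s ≡ + (s ℕ.+ s)
  s+s≡ = sym (ℤP.pos-+ s s)

hasFixedHook⇔ : (h : ℤ) (xs : List ℕ) → HasFixedHook h xs ⇔ ∃ λ j → j < length xs × FixedHookAt h xs j
hasFixedHook⇔ h xs = mk⇔
  (λ (i , eq) → toℕ i , FinP.toℕ<n i , Equivalence.to (hook1⇔fixedHookAt h xs i) eq)
  (λ (j , j<len , eq) → fromℕ< j<len , Equivalence.from (hook1⇔fixedHookAt h xs (fromℕ< j<len))
                                          (subst (FixedHookAt h xs) (sym (FinP.toℕ-fromℕ< j<len)) eq))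

same-offset : {a c a′ c′ : ℕ} {h : ℤ} → + a ≡ + c + h → + a′ ≡ + c′ + h → a ℕ.+ c′ ≡ a′ ℕ.+ c
same-offset {a} {c} {a′} {c′} {h} eq eq′ = ℤP.+-injective (begin
  + (a ℕ.+ c′)     ≡⟨ ℤP.pos-+ a c′ ⟩
  + a + + c′       ≡⟨ cong (_+ + c′) eq ⟩
  + c + h + + c′   ≡⟨ ℤ+.xy∙z≈zy∙x (+ c) h (+ c′) ⟩
  + c′ + h + + c   ≡⟨ cong (_+ + c) eq′ ⟨
  + a′ + + c       ≡⟨ ℤP.pos-+ a′ c ⟨
  + (a′ ℕ.+ c)     ∎)

fixedHookAt-<-⊥ : (h : ℤ) (xs : List ℕ) → Linked _≥_ xs → {j j′ : ℕ} → j < j′ → j′ < length xs →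
                  FixedHookAt h xs j → FixedHookAt h xs j′ → ⊥
fixedHookAt-<-⊥ h xs linked j<j′ j′< hook hook′ = ℕP.<-irrefl (sym (same-offset {h = h} hook hook′))
  (ℕP.+-mono-≤-< (ℕP.+-monoˡ-≤ (length xs) (lookupℕ-antitone xs linked (ℕP.<⇒≤ j<j′) j′<))
                 (ℕP.+-mono-< (s≤s j<j′) (s≤s j<j′)))

fixedHookAt-unique : (h : ℤ) (xs : List ℕ) → Linked _≥_ xs → {j j′ : ℕ} → j < length xs → j′ < length xs →
                     FixedHookAt h xs j → FixedHookAt h xs j′ → j ≡ j′
fixedHookAt-unique h xs linked {j} {j′} j< j′< hook hook′ with ℕP.<-cmp j j′
... | tri< j<j′ _ _ = ⊥-elim (fixedHookAt-<-⊥ h xs linked j<j′ j′< hook hook′)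
... | tri≈ _ j≡j′ _ = j≡j′
... | tri> _ _ j′<j = ⊥-elim (fixedHookAt-<-⊥ h xs linked j′<j j< hook′ hook)

HookEquation : ℤ → ℕ → ℕ → ℕ → Set
HookEquation h j x m = + (x ℕ.+ m) ≡ + suc j + h

hookEquation? : (h : ℤ) (j x m : ℕ) → Dec (HookEquation h j x m)
hookEquation? h j x m = + (x ℕ.+ m) ℤ.≟ + suc j + h

fixedHookAt-++ : (h : ℤ) (ys zs : List ℕ) (x : ℕ) →
                 FixedHookAt h (ys ++ x ∷ zs) (length ys) ⇔ HookEquation h (length ys) x (length zs)
fixedHookAt-++ h ys zs x = mk⇔
  (λ hook → trans (sym (a+s-s≡a a s)) (from (trans (sym u≡) (trans hook (cong (_+ h) (sym s+s≡))))))
  (λ eq → trans u≡ (trans (to (trans (a+s-s≡a a s) eq)) (cong (_+ h) s+s≡)))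
  where
  j : ℕ
  j = length ys
  m : ℕ
  m = length zs
  a : ℤ
  a = + (x ℕ.+ m)
  s : ℤ
  s = + suc j
  open Equivalence (-≡+⇔≡+ (a + s) s h)
  a+s-s≡a : ∀ a s → a + s - s ≡ a
  a+s-s≡a = solve-∀
  rearrange : ∀ x j m → x ℕ.+ (j ℕ.+ suc m) ≡ x ℕ.+ m ℕ.+ suc j
  rearrange = ℕSolver.solve-∀
  u≡ : + (lookupℕ (ys ++ x ∷ zs) j ℕ.+ length (ys ++ x ∷ zs)) ≡ a + s
  u≡ = trans (cong +_ (trans (cong₂ ℕ._+_ (lookupℕ-++ ys zs x) (ListP.length-++ ys)) (rearrange x j m)))
             (ℤP.pos-+ (x ℕ.+ m) (suc j))
  s+s≡ : s + s ≡ + (suc j ℕ.+ suc j)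
  s+s≡ = sym (ℤP.pos-+ (suc j) (suc j))

𝟙-fixedHookAt-++ : (h : ℤ) (ys zs : List ℕ) (x : ℕ) {j m : ℕ} → length ys ≡ j → length zs ≡ m →
                   𝟙 (fixedHookAt? h (ys ++ x ∷ zs) j) ≡ 𝟙 (hookEquation? h j x m)
𝟙-fixedHookAt-++ h ys zs x refl refl =
  𝟙-cong (fixedHookAt? h (ys ++ x ∷ zs) (length ys)) (hookEquation? h (length ys) x (length zs))
         (Equivalence.to (fixedHookAt-++ h ys zs x)) (Equivalence.from (fixedHookAt-++ h ys zs x))

𝟙-partitionWithFixedHook : (h : ℤ) (n : ℕ) (xs : List ℕ) →
  𝟙 (isPartition? n xs ×-dec hasFixedHook? h xs) ≡ ∑< (length xs) (λ j → 𝟙 (isPartition? n xs) * 𝟙 (fixedHookAt? h xs j))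
𝟙-partitionWithFixedHook h n xs = begin
  𝟙 (isPartition? n xs ×-dec hasFixedHook? h xs)
    ≡⟨ 𝟙-× (isPartition? n xs) (hasFixedHook? h xs) ⟩
  𝟙 (isPartition? n xs) * 𝟙 (hasFixedHook? h xs)
    ≡⟨ 𝟙-*-cong (isPartition? n xs) (λ (_ , linked , _) → sym
         (∑<-𝟙-unique (length xs) (fixedHookAt? h xs) (hasFixedHook? h xs) (hasFixedHook⇔ h xs) (fixedHookAt-unique h xs linked))) ⟩
  𝟙 (isPartition? n xs) * ∑< (length xs) (𝟙 ∘ fixedHookAt? h xs)
    ≡⟨ ∑-*ˡ (𝟙 (isPartition? n xs)) (𝟙 ∘ fixedHookAt? h xs) (upTo (length xs)) ⟩
  ∑< (length xs) (λ j → 𝟙 (isPartition? n xs) * 𝟙 (fixedHookAt? h xs j))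
    ∎

-- Counting partitions with a fixed hook

hookTerm : ℕ → ℕ → ℕ → Series
hookTerm j x m = mono (j ℕ.* x ℕ.+ (x ℕ.+ m)) ⊛ (invPoch j ⊛ gaussian m (x ∸ 1))

hookTerm-vanish : (j x m n : ℕ) → n < j ℕ.* x ℕ.+ (x ℕ.+ m) → hookTerm j x m n ≡ + 0
hookTerm-vanish j x m n = mono-⊛-< (j ℕ.* x ℕ.+ (x ℕ.+ m)) n (invPoch j ⊛ gaussian m (x ∸ 1))

countThroughPivot : (n j m x : ℕ) → 1 ≤ x → x ≤ n →
  ∑ (λ ys → ∑ (λ zs → nonincr𝟙 x n ys * nonincr𝟙 1 x zs * 𝟙 (sumℕ ys ℕ.+ (x ℕ.+ sumℕ zs) ℕ.≟ n)) (listsOf m n)) (listsOf j n)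
    ≡ hookTerm j x m n
countThroughPivot n j m x 1≤x x≤n = begin
  ∑ (λ ys → ∑ (λ zs → nonincr𝟙 x n ys * nonincr𝟙 1 x zs * 𝟙 (sumℕ ys ℕ.+ (x ℕ.+ sumℕ zs) ℕ.≟ n)) (listsOf m n)) (listsOf j n)
    ≡⟨ gf-product (nonincr𝟙 x n) sumℕ (listsOf j n) (nonincr𝟙 1 x) (λ zs → x ℕ.+ sumℕ zs) (listsOf m n) n ⟩
  (gf (nonincr𝟙 x n) sumℕ (listsOf j n) ⊛ gf (nonincr𝟙 1 x) (λ zs → x ℕ.+ sumℕ zs) (listsOf m n)) n
    ≡⟨ ⊛-cong (gf-nonincr j x n n 1≤x x≤n ℕP.≤-refl)
              (λ r → trans (gf-shift x (nonincr𝟙 1 x) sumℕ (listsOf m n) r)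
                           (⊛-congʳ (mono x) (gf-nonincr m 1 x n ℕP.≤-refl 1≤x x≤n) r)) n ⟩
  (nonincrGF j x (n ∸ x) ⊛ (mono x ⊛ nonincrGF m 1 (x ∸ 1))) n
    ≡⟨ ⊛-cong (nonincrGF-gaussian j x (n ∸ x)) (⊛-congʳ (mono x) (nonincrGF-gaussian m 1 (x ∸ 1))) n ⟩
  ((mono (j ℕ.* x) ⊛ G) ⊛ (mono x ⊛ (mono (m ℕ.* 1) ⊛ G′))) n
    ≡⟨ solve 5 (λ a G b c G′ → (a :* G) :* (b :* (c :* G′)) := (a :* (b :* c)) :* (G :* G′)) (λ _ → refl)
               (mono (j ℕ.* x)) G (mono x) (mono (m ℕ.* 1)) G′ n ⟩
  ((mono (j ℕ.* x) ⊛ (mono x ⊛ mono (m ℕ.* 1))) ⊛ (G ⊛ G′)) n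
    ≡⟨ ⊛-congˡ (G ⊛ G′) (λ r → trans (trans (⊛-congʳ (mono (j ℕ.* x)) (mono-+ x (m ℕ.* 1)) r) (mono-+ (j ℕ.* x) (x ℕ.+ m ℕ.* 1) r))
                                      (cong (λ k → mono (j ℕ.* x ℕ.+ (x ℕ.+ k)) r) (ℕP.*-identityʳ m))) n ⟩
  (mono E ⊛ (G ⊛ G′)) n
    ≡⟨ mono-⊛ E n (G ⊛ G′) ⟩
  𝟙 (E ≤? n) * (G ⊛ G′) (n ∸ E)
    -- parts are capped at n, but [j + (n − x); j]_q agrees with 1/(q)_j up to degree n − x
    ≡⟨ 𝟙-*-cong (E ≤? n) (λ _ → ⊛-cong-≤ G′ (n ∸ E) (λ i i≤n∸E → gaussian-≤ j (n ∸ x) i (ℕP.≤-trans i≤n∸E (ℕP.∸-monoʳ-≤ n x≤E)))) ⟩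
  𝟙 (E ≤? n) * (invPoch j ⊛ G′) (n ∸ E)
    ≡⟨ mono-⊛ E n (invPoch j ⊛ G′) ⟨
  hookTerm j x m n
    ∎
  where
  E : ℕ
  E = j ℕ.* x ℕ.+ (x ℕ.+ m)
  G : Series
  G = gaussian j (n ∸ x)
  G′ : Series
  G′ = gaussian m (x ∸ 1)
  x≤E : x ≤ E
  x≤E = ℕP.≤-trans (ℕP.m≤m+n x m) (ℕP.m≤n+m (x ℕ.+ m) (j ℕ.* x))

∑-listsOf-fixedHookAt : (h : ℤ) (n j m : ℕ) →
  ∑ (λ xs → 𝟙 (isPartition? n xs) * 𝟙 (fixedHookAt? h xs j)) (listsOf (j ℕ.+ suc m) n)
    ≡ ∑< n (λ x → 𝟙 (hookEquation? h j (suc x) m) * hookTerm j (suc x) m n)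
∑-listsOf-fixedHookAt h n j m = begin
  ∑ w (listsOf (j ℕ.+ suc m) n)
    ≡⟨ ∑-listsOf-+ j (suc m) n w ⟩
  ∑ (λ ys → ∑ (λ zs′ → w (ys ++ zs′)) (listsOf (suc m) n)) (listsOf j n)
    ≡⟨ ∑-cong (λ ys → ∑-listsOf-suc m n (λ zs′ → w (ys ++ zs′))) (listsOf j n) ⟩
  ∑ (λ ys → ∑< n (λ x → ∑ (λ zs → w (ys ++ suc x ∷ zs)) (listsOf m n))) (listsOf j n)
    ≡⟨ ∑-listsOf-cong j n (λ ys |ys| → ∑<-cong n (λ x x<n → ∑-listsOf-cong m n (λ zs |zs| → split ys zs x |ys| |zs| x<n))) ⟩
  ∑ (λ ys → ∑< n (λ x → ∑ (λ zs → 𝟙 (hook? x) * V x ys zs) (listsOf m n))) (listsOf j n)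
    ≡⟨ ∑-comm (λ ys x → ∑ (λ zs → 𝟙 (hook? x) * V x ys zs) (listsOf m n)) (listsOf j n) (upTo n) ⟩
  ∑< n (λ x → ∑ (λ ys → ∑ (λ zs → 𝟙 (hook? x) * V x ys zs) (listsOf m n)) (listsOf j n))
    ≡⟨ ∑<-cong n (λ x x<n → trans (pull𝟙 x) (cong (𝟙 (hook? x) *_) (countThroughPivot n j m (suc x) (s≤s z≤n) x<n))) ⟩
  ∑< n (λ x → 𝟙 (hook? x) * hookTerm j (suc x) m n)
    ∎
  where
  w : List ℕ → ℤ
  w xs = 𝟙 (isPartition? n xs) * 𝟙 (fixedHookAt? h xs j)
  hook? : (x : ℕ) → Dec (HookEquation h j (suc x) m)
  hook? x = hookEquation? h j (suc x) m
  V : ℕ → List ℕ → List ℕ → ℤ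
  V x ys zs = nonincr𝟙 (suc x) n ys * nonincr𝟙 1 (suc x) zs * 𝟙 (sumℕ ys ℕ.+ (suc x ℕ.+ sumℕ zs) ℕ.≟ n)
  split : ∀ ys zs x → length ys ≡ j → length zs ≡ m → x < n → w (ys ++ suc x ∷ zs) ≡ 𝟙 (hook? x) * V x ys zs
  split ys zs x |ys| |zs| x<n = trans
    (cong₂ _*_ (trans (𝟙-isPartition n (ys ++ suc x ∷ zs))
                      (cong₂ _*_ (nonincr𝟙-++ 1 n (suc x) ys zs (s≤s z≤n) x<n)
                                 (cong (λ s → 𝟙 (s ℕ.≟ n)) (sum-++ ys (suc x ∷ zs)))))
               (𝟙-fixedHookAt-++ h ys zs (suc x) |ys| |zs|))
    (ℤP.*-comm (V x ys zs) (𝟙 (hook? x)))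
  pull𝟙 : ∀ x → ∑ (λ ys → ∑ (λ zs → 𝟙 (hook? x) * V x ys zs) (listsOf m n)) (listsOf j n)
              ≡ 𝟙 (hook? x) * ∑ (λ ys → ∑ (V x ys) (listsOf m n)) (listsOf j n)
  pull𝟙 x = trans (∑-cong (λ ys → sym (∑-*ˡ (𝟙 (hook? x)) (V x ys) (listsOf m n))) (listsOf j n))
                  (sym (∑-*ˡ (𝟙 (hook? x)) (λ ys → ∑ (V x ys) (listsOf m n)) (listsOf j n)))

c≡∑hookTerm : (h : ℤ) (n : ℕ) →
  + c h n ≡ ∑< n (λ j → ∑< (n ∸ j) (λ m → ∑< n (λ x → 𝟙 (hookEquation? h j (suc x) m) * hookTerm j (suc x) m n)))
c≡∑hookTerm h n = begin
  + c h n
    ≡⟨ length-filter partitionWithFixedHook? (candidates n) ⟩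
  ∑ (𝟙 ∘ partitionWithFixedHook?) (candidates n)
    ≡⟨ ∑-concatMap (𝟙 ∘ partitionWithFixedHook?) (λ t → listsOf t n) (upTo (suc n)) ⟩
  ∑< (suc n) (λ t → ∑ (𝟙 ∘ partitionWithFixedHook?) (listsOf t n))
    ≡⟨ ∑-cong (λ t → ∑-listsOf-cong t n (λ xs |xs| → trans (𝟙-partitionWithFixedHook h n xs) (cong (λ l → ∑< l (λ j → w j xs)) |xs|))) (upTo (suc n)) ⟩
  ∑< (suc n) (λ t → ∑ (λ xs → ∑< t (λ j → w j xs)) (listsOf t n))
    ≡⟨ ∑-cong (λ t → ∑-comm (λ xs j → w j xs) (listsOf t n) (upTo t)) (upTo (suc n)) ⟩
  ∑< (suc n) (λ t → ∑< t (λ j → ∑ (w j) (listsOf t n)))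
    ≡⟨ trans (∑<-sucˡ n (λ t → ∑< t (λ j → ∑ (w j) (listsOf t n)))) (ℤP.+-identityˡ _) ⟩
  ∑< n (λ t → ∑< (suc t) (λ j → ∑ (w j) (listsOf (suc t) n)))
    ≡⟨ ∑<-triangle n (λ t j → ∑ (w j) (listsOf (suc t) n)) ⟩
  ∑< n (λ j → ∑< (n ∸ j) (λ m → ∑ (w j) (listsOf (suc (j ℕ.+ m)) n)))
    ≡⟨ ∑-cong (λ j → ∑-cong (λ m → trans (cong (λ t → ∑ (w j) (listsOf t n)) (sym (ℕP.+-suc j m)))
                                         (∑-listsOf-fixedHookAt h n j m)) (upTo (n ∸ j))) (upTo n) ⟩
  ∑< n (λ j → ∑< (n ∸ j) (λ m → ∑< n (λ x → 𝟙 (hookEquation? h j (suc x) m) * hookTerm j (suc x) m n)))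
    ∎
  where
  partitionWithFixedHook? : (xs : List ℕ) → Dec (IsPartition n xs × HasFixedHook h xs)
  partitionWithFixedHook? xs = isPartition? n xs ×-dec hasFixedHook? h xs
  w : ℕ → List ℕ → ℤ
  w j xs = 𝟙 (isPartition? n xs) * 𝟙 (fixedHookAt? h xs j)

-- The two double series

coeffZ-∸ : (f : Series) (n e : ℕ) → coeffZ f (+ n - + e) ≡ (mono e ⊛ f) n
coeffZ-∸ f n e with e ≤? n
... | yes e≤n = trans (cong (coeffZ f) (trans (ℤP.m-n≡m⊖n n e) (ℤP.⊖-≥ e≤n))) (sym (mono-⊛-≥ e n f e≤n))
... | no  e≰n = trans (cong (coeffZ f) (trans (ℤP.m-n≡m⊖n n e) (ℤP.⊖-< (ℕP.≰⇒> e≰n))))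
                      (trans (coeffZ-neg (e ∸ n) (ℕP.m>n⇒m∸n≢0 (ℕP.≰⇒> e≰n))) (sym (mono-⊛-< e n f (ℕP.≰⇒> e≰n))))
  where
  coeffZ-neg : ∀ d → d ≢ 0 → coeffZ f (- + d) ≡ + 0
  coeffZ-neg zero    d≢0 = ⊥-elim (d≢0 refl)
  coeffZ-neg (suc d) _   = refl

coeffZ-mono-⊛ : (e : ℕ) (f : Series) (w : ℤ) → coeffZ (mono e ⊛ f) w ≡ coeffZ f (w - + e)
coeffZ-mono-⊛ e       f (+ n)    = sym (coeffZ-∸ f n e)
coeffZ-mono-⊛ zero    f -[1+ _ ] = refl
coeffZ-mono-⊛ (suc e) f -[1+ _ ] = refl

coeffZ-zeroS-⊛ : (g : Series) (w : ℤ) → coeffZ (zeroS ⊛ g) w ≡ + 0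
coeffZ-zeroS-⊛ g (+ n)    = ∑-zero (λ i → ℤP.*-zeroˡ (g (n ∸ i))) (upTo (suc n))
coeffZ-zeroS-⊛ g -[1+ _ ] = refl

coeffZ-cong : {f g : Series} → f ≗ g → (w : ℤ) → coeffZ f w ≡ coeffZ g w
coeffZ-cong f≗g (+ n)    = f≗g n
coeffZ-cong f≗g -[1+ _ ] = refl

term1-vanish : (h : ℤ) (k l n : ℕ) → n < k → term1 h k l n ≡ + 0
term1-vanish h k l n n<k = vanish (+ k - h - + 1)
  where
  F : ℕ → Series
  F j = invPoch j ⊛ qbinom (k ∸ 1) (l ∸ 1)
  vanish : (z : ℤ) → coeffZ (invPochZ z ⊛ qbinom (k ∸ 1) (l ∸ 1)) (+ n - (+ k + + l * z)) ≡ + 0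
  vanish (+ j)    = begin
    coeffZ (F j) (+ n - (+ k + + l * + j))   ≡⟨ cong (λ e → coeffZ (F j) (+ n - e)) (trans (cong (_+_ (+ k)) (sym (ℤP.pos-* l j))) (sym (ℤP.pos-+ k (l ℕ.* j)))) ⟩
    coeffZ (F j) (+ n - + (k ℕ.+ l ℕ.* j))   ≡⟨ coeffZ-∸ (F j) n (k ℕ.+ l ℕ.* j) ⟩
    (mono (k ℕ.+ l ℕ.* j) ⊛ F j) n           ≡⟨ mono-⊛-< (k ℕ.+ l ℕ.* j) n (F j) (ℕP.≤-trans n<k (ℕP.m≤m+n k (l ℕ.* j))) ⟩
    + 0                                      ∎
  vanish z@(-[1+ _ ]) = coeffZ-zeroS-⊛ (qbinom (k ∸ 1) (l ∸ 1)) (+ n - (+ k + + l * z))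

hookEquation⇔ : (h : ℤ) (j x m : ℕ) → HookEquation h j x m ⇔ (+ (x ℕ.+ m) - h - + 1 ≡ + j)
hookEquation⇔ h j x m = mk⇔
  (λ eq → trans (cong (λ a → a - h - + 1) eq) (1+j+h-h-1≡j (+ j) h))
  (λ eq → trans (a≡1+[a-h-1]+h (+ (x ℕ.+ m)) h) (cong (λ b → + 1 + b + h) eq))
  where
  1+j+h-h-1≡j : ∀ j h → + 1 + j + h - h - + 1 ≡ j
  1+j+h-h-1≡j = solve-∀
  a≡1+[a-h-1]+h : ∀ a h → a ≡ + 1 + (a - h - + 1) + h
  a≡1+[a-h-1]+h = solve-∀

𝟙<-*-hookTerm : (j x m n : ℕ) → 𝟙 (j <? n) * hookTerm j (suc x) m n ≡ hookTerm j (suc x) m n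
𝟙<-*-hookTerm j x m n with j <? n
... | yes _  = ℤP.*-identityˡ (hookTerm j (suc x) m n)
... | no j≮n = sym (hookTerm-vanish j (suc x) m n (ℕP.≤-<-trans (ℕP.≮⇒≥ j≮n) j<E))
  where
  j<E : j < j ℕ.* suc x ℕ.+ (suc x ℕ.+ m)
  j<E = ℕP.≤-trans (ℕP.≤-reflexive (ℕP.+-comm 1 j)) (ℕP.+-mono-≤ (ℕP.m≤m*n j (suc x)) (s≤s z≤n))

term1-hookTerm : (h : ℤ) (n l m : ℕ) →
  term1 h (suc (l ℕ.+ m)) (suc l) n ≡ ∑< n (λ j → 𝟙 (hookEquation? h j (suc l) m) * hookTerm j (suc l) m n)
term1-hookTerm h n l m = byExponent (+ (x ℕ.+ m) - h - + 1) refl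
  where
  x : ℕ
  x = suc l
  T : ℕ → ℤ
  T j = hookTerm j x m n
  rearrange : ∀ x m j → x ℕ.+ m ℕ.+ x ℕ.* j ≡ j ℕ.* x ℕ.+ (x ℕ.+ m)
  rearrange = ℕSolver.solve-∀
  neg≢pos : ∀ {d j} → -[1+ d ] ≢ + j
  neg≢pos ()
  byExponent : (z : ℤ) → + (x ℕ.+ m) - h - + 1 ≡ z →
               coeffZ (invPochZ z ⊛ qbinom (l ℕ.+ m) l) (+ n - (+ (x ℕ.+ m) + + x * z)) ≡ ∑< n (λ j → 𝟙 (hookEquation? h j x m) * T j)
  byExponent (+ j₀) z≡j₀ = begin
    coeffZ (invPoch j₀ ⊛ qbinom (l ℕ.+ m) l) (+ n - (+ (x ℕ.+ m) + + x * + j₀))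
      ≡⟨ cong (λ e → coeffZ (invPoch j₀ ⊛ qbinom (l ℕ.+ m) l) (+ n - e))
              (trans (cong (_+_ (+ (x ℕ.+ m))) (sym (ℤP.pos-* x j₀))) (sym (ℤP.pos-+ (x ℕ.+ m) (x ℕ.* j₀)))) ⟩
    coeffZ (invPoch j₀ ⊛ gaussian l m) (+ n - + (x ℕ.+ m ℕ.+ x ℕ.* j₀))
      ≡⟨ coeffZ-∸ (invPoch j₀ ⊛ gaussian l m) n (x ℕ.+ m ℕ.+ x ℕ.* j₀) ⟩
    (mono (x ℕ.+ m ℕ.+ x ℕ.* j₀) ⊛ (invPoch j₀ ⊛ gaussian l m)) n
      ≡⟨ ⊛-cong (λ r → cong (λ e → mono e r) (rearrange x m j₀)) (⊛-congʳ (invPoch j₀) (gaussian-comm l m)) n ⟩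
    T j₀
      ≡⟨ 𝟙<-*-hookTerm j₀ l m n ⟨
    𝟙 (j₀ <? n) * T j₀
      ≡⟨ ∑<-delta n j₀ T ⟨
    ∑< n (λ j → 𝟙 (j₀ ℕ.≟ j) * T j)
      ≡⟨ ∑-cong (λ j → cong (_* T j) (𝟙-cong (j₀ ℕ.≟ j) (hookEquation? h j x m)
                                             (λ { refl → Equivalence.from (hookEquation⇔ h j x m) z≡j₀ })
                                             (λ eq → ℤP.+-injective (trans (sym z≡j₀) (Equivalence.to (hookEquation⇔ h j x m) eq)))))
                (upTo n) ⟩
    ∑< n (λ j → 𝟙 (hookEquation? h j x m) * T j)
      ∎
  byExponent z@(-[1+ _ ]) z≡neg = trans (coeffZ-zeroS-⊛ (qbinom (l ℕ.+ m) l) (+ n - (+ (x ℕ.+ m) + + x * z)))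
    (sym (∑<-zero n (λ j _ → cong (_* T j) (𝟙-no (hookEquation? h j x m)
                                                 (λ eq → neg≢pos (trans (sym z≡neg) (Equivalence.to (hookEquation⇔ h j x m) eq)))))))

term2≡term1 : (h : ℤ) (l k n : ℕ) → term2 h l k n ≡ term1 h k l n
term2≡term1 h l k n = begin
  coeffZ (mono e ⊛ invPochZ z ⊛ Q) w         ≡⟨ coeffZ-cong (⊛-assoc (mono e) (invPochZ z) Q) w ⟩
  coeffZ (mono e ⊛ (invPochZ z ⊛ Q)) w       ≡⟨ coeffZ-mono-⊛ e (invPochZ z ⊛ Q) w ⟩
  coeffZ (invPochZ z ⊛ Q) (w - + e)          ≡⟨ cong (coeffZ (invPochZ z ⊛ Q)) exponent ⟩
  term1 h k l n                              ∎
  where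
  e : ℕ
  e = suc l ℕ.* k
  z : ℤ
  z = + k - h - + 1
  Q : Series
  Q = qbinom (k ∸ 1) (l ∸ 1)
  w : ℤ
  w = + n - + l * (- h - + 1)
  shift : ∀ n l h k → n - l * (- h - + 1) - (+ 1 + l) * k ≡ n - (k + l * (k - h - + 1))
  shift = solve-∀
  exponent : w - + e ≡ + n - (+ k + + l * z)
  exponent = trans (cong (_-_ w) (trans (ℤP.pos-* (suc l) k) (cong (_* + k) (ℤP.pos-+ 1 l)))) (shift (+ n) (+ l) h (+ k))

term1Sum : ℤ → ℕ → ℤ
term1Sum h n = ∑< n (λ l → ∑< (n ∸ l) (λ m → term1 h (suc (l ℕ.+ m)) (suc l) n))

partial1-stable : (h : ℤ) (K n : ℕ) → n ≤ K → partial1 h K n ≡ term1Sum h n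
partial1-stable h K n n≤K = begin
  ∑ (λ k → ∑ (λ l → term1 h k l n) (range 1 k)) (range 1 K)
    ≡⟨ ∑-map (λ k → ∑ (λ l → term1 h k l n) (range 1 k)) suc (upTo K) ⟩
  ∑< K (λ k → ∑ (λ l → term1 h (suc k) l n) (range 1 (suc k)))
    ≡⟨ ∑-cong (λ k → ∑-map (λ l → term1 h (suc k) l n) suc (upTo (suc k))) (upTo K) ⟩
  ∑< K (λ k → ∑< (suc k) (λ l → term1 h (suc k) (suc l) n))
    ≡⟨ ∑<-extend n K n≤K _ (λ k n≤k _ → ∑<-zero (suc k) (λ l _ → term1-vanish h (suc k) (suc l) n (s≤s n≤k))) ⟩
  ∑< n (λ k → ∑< (suc k) (λ l → term1 h (suc k) (suc l) n))
    ≡⟨ ∑<-triangle n (λ k l → term1 h (suc k) (suc l) n) ⟩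
  term1Sum h n
    ∎

inner2-stable : (h : ℤ) (l K n : ℕ) → n ≤ K → inner2 h l K n ≡ inner2 h l n n
inner2-stable h l K n n≤K = begin
  ∑ (λ k → term2 h l k n) (range l K)
    ≡⟨ ∑-map (λ k → term2 h l k n) (l ℕ.+_) (upTo (suc K ∸ l)) ⟩
  ∑< (suc K ∸ l) (λ i → term2 h l (l ℕ.+ i) n)
    ≡⟨ ∑<-extend (suc n ∸ l) (suc K ∸ l) (ℕP.∸-monoˡ-≤ l (s≤s n≤K)) (λ i → term2 h l (l ℕ.+ i) n)
         (λ i n<l+i _ → trans (term2≡term1 h l (l ℕ.+ i) n)
                              (term1-vanish h (l ℕ.+ i) l n (ℕP.≤-trans (ℕP.m≤n+m∸n (suc n) l) (ℕP.+-monoʳ-≤ l n<l+i)))) ⟩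
  ∑< (suc n ∸ l) (λ i → term2 h l (l ℕ.+ i) n)
    ≡⟨ ∑-map (λ k → term2 h l k n) (l ℕ.+_) (upTo (suc n ∸ l)) ⟨
  ∑ (λ k → term2 h l k n) (range l n)
    ∎

outer-stable : (h : ℤ) (L n : ℕ) → n ≤ L → ∑ (λ l → inner2 h l n n) (range 1 L) ≡ term1Sum h n
outer-stable h L n n≤L = begin
  ∑ (λ l → inner2 h l n n) (range 1 L)
    ≡⟨ ∑-map (λ l → inner2 h l n n) suc (upTo L) ⟩
  ∑< L (λ l → inner2 h (suc l) n n)
    ≡⟨ ∑<-extend n L n≤L (λ l → inner2 h (suc l) n n)
         (λ l n≤l _ → cong (λ r → ∑ (λ k → term2 h (suc l) k n) (List.map (suc l ℕ.+_) (upTo r))) (ℕP.m≤n⇒m∸n≡0 n≤l)) ⟩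
  ∑< n (λ l → inner2 h (suc l) n n)
    ≡⟨ ∑-cong (λ l → trans (∑-map (λ k → term2 h (suc l) k n) (suc l ℕ.+_) (upTo (n ∸ l)))
                           (∑-cong (λ i → term2≡term1 h (suc l) (suc l ℕ.+ i) n) (upTo (n ∸ l)))) (upTo n) ⟩
  term1Sum h n
    ∎

term1Sum≡c : (h : ℤ) (n : ℕ) → term1Sum h n ≡ + c h n
term1Sum≡c h n = begin
  term1Sum h n
    ≡⟨ ∑-cong (λ x → ∑-cong (λ m → term1-hookTerm h n x m) (upTo (n ∸ x))) (upTo n) ⟩
  ∑< n (λ x → ∑< (n ∸ x) (λ m → ∑< n (λ j → C j x m)))
    ≡⟨ ∑-cong (λ x → ∑<-extend (n ∸ x) n (ℕP.m∸n≤m n x) (λ m → ∑< n (λ j → C j x m))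
                                (λ m n∸x≤m _ → ∑<-zero n (λ j _ → C-vanish j x m (past-x j x m n∸x≤m)))) (upTo n) ⟨
  ∑< n (λ x → ∑< n (λ m → ∑< n (λ j → C j x m)))
    ≡⟨ ∑-cong (λ x → ∑-comm (λ m j → C j x m) (upTo n) (upTo n)) (upTo n) ⟩
  ∑< n (λ x → ∑< n (λ j → ∑< n (λ m → C j x m)))
    ≡⟨ ∑-comm (λ x j → ∑< n (λ m → C j x m)) (upTo n) (upTo n) ⟩
  ∑< n (λ j → ∑< n (λ x → ∑< n (λ m → C j x m)))
    ≡⟨ ∑-cong (λ j → ∑-comm (λ x m → C j x m) (upTo n) (upTo n)) (upTo n) ⟩
  ∑< n (λ j → ∑< n (λ m → ∑< n (λ x → C j x m)))
    ≡⟨ ∑-cong (λ j → ∑<-extend (n ∸ j) n (ℕP.m∸n≤m n j) (λ m → ∑< n (λ x → C j x m))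
                                (λ m n∸j≤m _ → ∑<-zero n (λ x _ → C-vanish j x m (past-j j x m n∸j≤m)))) (upTo n) ⟩
  ∑< n (λ j → ∑< (n ∸ j) (λ m → ∑< n (λ x → C j x m)))
    ≡⟨ c≡∑hookTerm h n ⟨
  + c h n
    ∎
  where
  C : ℕ → ℕ → ℕ → ℤ
  C j x m = 𝟙 (hookEquation? h j (suc x) m) * hookTerm j (suc x) m n
  C-vanish : ∀ j x m → n < j ℕ.* suc x ℕ.+ (suc x ℕ.+ m) → C j x m ≡ + 0
  C-vanish j x m n<E = trans (cong (𝟙 (hookEquation? h j (suc x) m) *_) (hookTerm-vanish j (suc x) m n n<E))
                             (ℤP.*-zeroʳ (𝟙 (hookEquation? h j (suc x) m)))
  past-x : ∀ j x m → n ∸ x ≤ m → n < j ℕ.* suc x ℕ.+ (suc x ℕ.+ m)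
  past-x j x m n∸x≤m = ℕP.≤-trans (s≤s (ℕP.≤-trans (ℕP.m≤n+m∸n n x) (ℕP.+-monoʳ-≤ x n∸x≤m)))
                                  (ℕP.m≤n+m (suc x ℕ.+ m) (j ℕ.* suc x))
  past-j : ∀ j x m → n ∸ j ≤ m → n < j ℕ.* suc x ℕ.+ (suc x ℕ.+ m)
  past-j j x m n∸j≤m = ℕP.≤-trans (s≤s (ℕP.≤-trans (ℕP.m≤n+m∸n n j) (ℕP.+-monoʳ-≤ j n∸j≤m)))
    (ℕP.≤-trans (ℕP.≤-reflexive (sym (ℕP.+-suc j m))) (ℕP.+-mono-≤ (ℕP.m≤m*n j (suc x)) (s≤s (ℕP.m≤n+m m x))))

mainTheorem7 : (h : ℤ) (n : ℕ) →
    (∃[ M ] ∀ K → M ≤ K → partial1 h K n ≡ + c h n)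
    × (∃[ inner ]
        ((∀ l → ∃[ M ] ∀ K → M ≤ K → inner2 h l K n ≡ inner l)
         × (∃[ M ] ∀ L → M ≤ L → sumℤ (map inner (range 1 L)) ≡ + c h n)))
mainTheorem7 h n =
  (n , λ K n≤K → trans (partial1-stable h K n n≤K) (term1Sum≡c h n)) ,
  (λ l → inner2 h l n n) ,
  (λ l → n , λ K n≤K → inner2-stable h l K n n≤K) ,
  (n , λ L n≤L → trans (outer-stable h L n n≤L) (term1Sum≡c h n))
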